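{- Let $u_n=\sum_{\pi\in\mathcal{D}_{21\text{ - }3}(n)}y^{\mu(\pi)}$ for $n\ge2$, with $u_1=0$, and for $2\le i\le n$ let $u_{n,i}$ be the same sum restricted to those $\pi$ whose flattened form has second letter $i$. Then for $n\ge4$, $$u_{n,i}=\sum_{j=i}^{n-1}u_{n-1,j},\qquad 3\le i\le n-1,$$ and moreover $u_{n,2}=u_{n,n}=u_{n-1}+yu_{n-2}$ for $n\ge3$, and $u_{2,2}=y$.
   Context: Every permutation $\pi$ of $[n]=\{1,\dots,n\}$ is written in standard cycle form: each cycle is written starting with its smallest element, and the cycles are ordered from left to right by increasing first elements. The flattened form $\mathrm{flat}(\pi)$ is the word (in one-line notation) obtained by erasing the parentheses of the standard cycle form. A derangement is a permutation with no fixed points; $\mathcal{D}(n)$ is the set of derangements of $[n]$, and $\mu(\pi)$ denotes the number of cycles of $\pi$. A word $w=w_1\cdots w_n$ of distinct integers contains the vincular pattern $21\text{ - }3$ if there are indices $i$ and $k>i+1$ with $w_{i+1}<w_i<w_k$, and avoids it otherwise. $\mathcal{D}_{21\text{ - }3}(n)$ is the set of $\pi\in\mathcal{D}(n)$ such that $\mathrm{flat}(\pi)$ avoids $21\text{ - }3$. -}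

module Defs where

open import Data.Nat using (ℕ; zero; suc; _+_; _∸_; _≡ᵇ_; _<ᵇ_; _≤ᵇ_)
open import Data.Bool using (Bool; true; false; _∧_; _∨_; not; if_then_else_)
open import Data.List using (List; []; _∷_; map; concatMap; filter; length; upTo; concat)
open import Data.Bool.ListAction using (all; any)
open import Data.Nat.ListAction using (sum)
open import Relation.Binary.PropositionalEquality using (_≡_)
open import Data.Product using (_×_)

-- Permutations of [n] = {1,…,n} in one-line notation: w = π(1) π(2) ⋯ π(n).

range1 : ℕ → List ℕ
range1 n = map suc (upTo n)

wordsOver : List ℕ → ℕ → List (List ℕ)
wordsOver as zero    = [] ∷ []
wordsOver as (suc m) = concatMap (λ w → map (λ a → a ∷ w) as) (wordsOver as m)

memb : ℕ → List ℕ → Bool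
memb x xs = any (λ y → x ≡ᵇ y) xs

distinct : List ℕ → Bool
distinct []       = true
distinct (x ∷ xs) = not (memb x xs) ∧ distinct xs

perms : ℕ → List (List ℕ)
perms n = filter (λ w → distinct w Data.Bool.≟ true) (wordsOver (range1 n) n)

-- π(i) for the one-line word w (1-indexed)
app : List ℕ → ℕ → ℕ
app []       _             = 0
app (x ∷ xs) zero          = 0
app (x ∷ xs) (suc zero)    = x
app (x ∷ xs) (suc (suc k)) = app xs (suc k)

-- the cycle of π through i, written starting at i: i, π(i), π²(i), … (fuel bounds length)
cycleFrom : List ℕ → ℕ → List ℕ
cycleFrom w i = go (length w) (app w i)
  where
  go : ℕ → ℕ → List ℕ
  go zero    j = []
  go (suc f) j = if j ≡ᵇ i then [] else (j ∷ go f (app w j))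

cycleOf : List ℕ → ℕ → List ℕ
cycleOf w i = i ∷ cycleFrom w i

isCycleMin : List ℕ → ℕ → Bool
isCycleMin w i = all (λ j → i ≤ᵇ j) (cycleOf w i)

cycleLeaders : List ℕ → List ℕ
cycleLeaders w = filter (λ i → isCycleMin w i Data.Bool.≟ true) (range1 (length w))

standardCycleForm : List ℕ → List (List ℕ)
standardCycleForm w = map (cycleOf w) (cycleLeaders w)

flat : List ℕ → List ℕ
flat w = concat (standardCycleForm w)

μ : List ℕ → ℕ
μ w = length (standardCycleForm w)

isDerangement : List ℕ → Bool
isDerangement w = all (λ i → not (app w i ≡ᵇ i)) (range1 (length w))

-- w contains 21-3: indices i, k > i+1 with w_{i+1} < w_i < w_k
contains21-3 : List ℕ → Bool
contains21-3 []           = false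
contains21-3 (a ∷ [])     = false
contains21-3 (a ∷ b ∷ r)  = ((b <ᵇ a) ∧ any (λ c → a <ᵇ c) r) ∨ contains21-3 (b ∷ r)

avoids21-3 : List ℕ → Bool
avoids21-3 w = not (contains21-3 w)

D21-3 : ℕ → List (List ℕ)
D21-3 n = filter (λ w → (isDerangement w ∧ avoids21-3 (flat w)) Data.Bool.≟ true) (perms n)

-- Polynomials in y with ℕ coefficients, as coefficient functions: p k = [y^k] p
Poly : Set
Poly = ℕ → ℕ

_≈P_ : Poly → Poly → Set
p ≈P q = ∀ k → p k ≡ q k

_+P_ : Poly → Poly → Poly
(p +P q) k = p k + q k

yP* : Poly → Poly
yP* p zero    = 0
yP* p (suc k) = p k

yP : Poly
yP (suc zero) = 1
yP _          = 0

zeroP : Poly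
zeroP _ = 0

-- Σ_{π ∈ S} y^{μ(π)} as a coefficient function
genPoly : List (List ℕ) → Poly
genPoly S k = length (filter (λ w → μ w Data.Nat.≟ k) S)

second : List ℕ → ℕ
second (a ∷ b ∷ _) = b
second _           = 0

u : ℕ → Poly
u (suc zero) = zeroP
u n          = genPoly (D21-3 n)

uI : ℕ → ℕ → Poly
uI n i = genPoly (filter (λ w → second (flat w) Data.Nat.≟ i) (D21-3 n))

sumFromTo : ℕ → ℕ → (ℕ → Poly) → Poly
sumFromTo a b f k = sum (map (λ j → f j k) (map (a +_) (upTo (suc b ∸ a))))

-- Let π be a derangement of [n] with π(1) = i ≥ 2, so that flat π begins with 1 i. Deleting i from
-- the cycle of 1 and renumbering the values above i gives σ ∈ S(n-1) with as many cycles as π, and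
-- flat π is 1 i followed by the renumbered tail of flat σ. So an occurrence of 21-3 in flat π that
-- does not come from flat σ consists of i, a smaller letter right after it, and a later larger letter.
-- For 3 ≤ i ≤ n-1 the letter n always comes later, hence π is counted iff σ is a 21-3-avoiding
-- derangement with σ(1) ≥ i (when σ(1) = 1 the letter after i is 2); grouping such σ by their second
-- letter σ(1) = j gives the sum. For i = 2 or i = n no new occurrence can arise, so either σ is itself
-- counted, or σ(1) = 1 and deleting this fixed point leaves a counted derangement of [n-2] with one
-- cycle fewer, which accounts for the term y·u(n-2).
module Submission where

open import Data.Bool using (Bool; true; false; _∧_; _∨_; not; if_then_else_; T)
open import Data.Bool.ListAction using (all; any; and; or)
open import Data.Bool.Properties using (T-≡; ¬-not; not-involutive; ∨-zeroʳ; ∧-zeroʳ)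
open import Data.Empty using (⊥; ⊥-elim)
open import Data.Fin using (Fin; toℕ; fromℕ<)
import Data.Fin.Properties as Fin
open import Data.List
  using (List; []; _∷_; _++_; map; drop; filter; length; concat; concatMap; upTo; applyUpTo)
open import Data.List.Properties
  using (length-map; length-upTo; ∷-injective; map-applyUpTo; map-++; map-∘; map-id; map-id-local; map-cong;
         map-cong-local; concat-map; filter-accept; filter-reject)
open import Data.List.Membership.Propositional using (_∈_; _∉_; find; lose)
open import Data.List.Membership.Propositional.Properties
  using (∈-map⁺; ∈-map⁻; ∈-filter⁺; ∈-filter⁻; ∈-concatMap⁺; ∈-concatMap⁻;
         ∈-concat⁺′; ∈-concat⁻′)
open import Data.List.Membership.Propositional.Properties.WithK using (unique∧set⇒bag)
open import Data.List.Relation.Binary.BagAndSetEquality using (∼bag⇒↭)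
open import Data.List.Relation.Binary.Permutation.Propositional.Properties using (↭-length)
import Data.List.Relation.Unary.All as All
open import Data.List.Relation.Unary.Any using (here; there)
open import Data.List.Relation.Unary.Unique.Propositional using (Unique; []; _∷_)
import Data.List.Relation.Unary.Unique.Propositional.Properties as Unique
open import Data.Nat
  using (ℕ; zero; suc; pred; _+_; _∸_; _≤_; _<_; z≤n; s≤s; s≤s⁻¹; z<s; _≤?_; _<?_;
         _≡ᵇ_; _<ᵇ_; _≤ᵇ_; NonZero; >-nonZero)
open import Data.Nat.Induction using (<-wellFounded)
open import Data.Nat.ListAction using (sum)
open import Data.Nat.Properties
open import Data.Product using (_×_; _,_; proj₁; proj₂; ∃-syntax)
import Data.Product as Product
open import Data.Sum using (_⊎_; inj₁; inj₂)
import Data.Sum as Sum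
open import Data.Unit using (tt)
open import Function using (_∘_; Equivalence; _⇔_; mk⇔)
import Function.Properties.Equivalence as ⇔
open import Induction.WellFounded using (Acc; acc)
open import Relation.Binary.PropositionalEquality
open import Relation.Nullary using (¬_; yes; no; does)
open import Relation.Nullary.Decidable using (_×-dec_; ¬?)
import Relation.Nullary.Decidable as Dec
open import Relation.Unary using (Decidable)
open import Relation.Unary.Properties using (_∩?_)

open import Defs

T⇒≡true : ∀ {b} → T b → b ≡ true
T⇒≡true = Equivalence.to T-≡

¬T⇒≡false : ∀ {b} → ¬ T b → b ≡ false
¬T⇒≡false {false} _  = refl
¬T⇒≡false {true}  ¬t = ⊥-elim (¬t tt)

≡ᵇ-true : ∀ m n → m ≡ n → (m ≡ᵇ n) ≡ true
≡ᵇ-true m n = T⇒≡true ∘ ≡⇒≡ᵇ m n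

≡ᵇ-false : ∀ m n → m ≢ n → (m ≡ᵇ n) ≡ false
≡ᵇ-false m n m≢n = ¬T⇒≡false (m≢n ∘ ≡ᵇ⇒≡ m n)

<ᵇ-true : ∀ m n → m < n → (m <ᵇ n) ≡ true
<ᵇ-true _ _ = T⇒≡true ∘ <⇒<ᵇ

<ᵇ-false : ∀ m n → ¬ m < n → (m <ᵇ n) ≡ false
<ᵇ-false m n m≮n = ¬T⇒≡false (m≮n ∘ <ᵇ⇒< m n)

≤ᵇ-true : ∀ m n → m ≤ n → (m ≤ᵇ n) ≡ true
≤ᵇ-true _ _ = T⇒≡true ∘ ≤⇒≤ᵇ

≤ᵇ-true⁻ : ∀ m n → (m ≤ᵇ n) ≡ true → m ≤ n
≤ᵇ-true⁻ m n = ≤ᵇ⇒≤ m n ∘ Equivalence.from T-≡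

false≢true : false ≢ true
false≢true ()

if-true : ∀ {A : Set} {b} {x y : A} → b ≡ true → (if b then x else y) ≡ x
if-true refl = refl

if-false : ∀ {A : Set} {b} {x y : A} → b ≡ false → (if b then x else y) ≡ y
if-false refl = refl

∧-trueˡ : ∀ {a b} → (a ∧ b) ≡ true → a ≡ true
∧-trueˡ {true} _ = refl

∧-trueʳ : ∀ {a b} → (a ∧ b) ≡ true → b ≡ true
∧-trueʳ {true} e = e

bool-ext : ∀ {a b : Bool} → (a ≡ true → b ≡ true) → (b ≡ true → a ≡ true) → a ≡ b
bool-ext {false} {false} _ _ = refl
bool-ext {false} {true}  _ g = g refl
bool-ext {true}  {false} f _ = sym (f refl)
bool-ext {true}  {true}  _ _ = refl

all-true⁻ : ∀ {A : Set} (p : A → Bool) {xs} → all p xs ≡ true → ∀ {z} → z ∈ xs → p z ≡ true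
all-true⁻ p {x ∷ _} e (here refl) = ∧-trueˡ {p x} e
all-true⁻ p {x ∷ _} e (there z∈) = all-true⁻ p (∧-trueʳ {p x} e) z∈

all-true⁺ : ∀ {A : Set} (p : A → Bool) xs → (∀ {z} → z ∈ xs → p z ≡ true) → all p xs ≡ true
all-true⁺ p []       _ = refl
all-true⁺ p (x ∷ xs) h rewrite h (here refl) = all-true⁺ p xs (h ∘ there)

all-false⁻ : ∀ {A : Set} (p : A → Bool) xs → all p xs ≡ false → ∃[ z ] (z ∈ xs × p z ≡ false)
all-false⁻ p (x ∷ xs) e with p x in px
... | false = x , here refl , px
... | true  = let z , z∈ , pz = all-false⁻ p xs e in z , there z∈ , pz

any-true⁺ : ∀ {A : Set} (p : A → Bool) {xs z} → z ∈ xs → p z ≡ true → any p xs ≡ true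
any-true⁺ p {y ∷ _}  (here refl) e rewrite e = refl
any-true⁺ p {y ∷ xs} (there z∈)  e rewrite any-true⁺ p z∈ e = ∨-zeroʳ (p y)

any-false⁺ : ∀ {A : Set} (p : A → Bool) xs → (∀ {z} → z ∈ xs → p z ≡ false) → any p xs ≡ false
any-false⁺ p []       _ = refl
any-false⁺ p (x ∷ xs) h rewrite h (here refl) = any-false⁺ p xs (h ∘ there)

-- The decider used by the filters in Defs, so that filter (true? b) matches them definitionally.
true? : ∀ {A : Set} (b : A → Bool) → Decidable (λ x → b x ≡ true)
true? b x = b x Data.Bool.≟ true

filter-map : ∀ {A B : Set} {P : B → Set} (P? : Decidable P) (f : A → B) xs →
  filter P? (map f xs) ≡ map f (filter (P? ∘ f) xs)
filter-map P? f []       = refl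
filter-map P? f (x ∷ xs) with P? (f x)
... | yes _ = cong (f x ∷_) (filter-map P? f xs)
... | no  _ = filter-map P? f xs

filter-∷-cong : ∀ {A : Set} {P : A → Set} (P? : Decidable P) x {xs ys} →
  filter P? xs ≡ filter P? ys → filter P? (x ∷ xs) ≡ filter P? (x ∷ ys)
filter-∷-cong P? x e with does (P? x)
... | true  = cong (x ∷_) e
... | false = e

filter-true?-cong : ∀ {A : Set} (b c : A → Bool) xs → (∀ {x} → x ∈ xs → b x ≡ c x) →
  filter (true? b) xs ≡ filter (true? c) xs
filter-true?-cong b c []       _ = refl
filter-true?-cong b c (x ∷ xs) h with true? b x | true? c x
... | yes _  | yes _  = cong (x ∷_) (filter-true?-cong b c xs (h ∘ there))
... | no  _  | no  _  = filter-true?-cong b c xs (h ∘ there)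
... | yes bx | no  cx = ⊥-elim (cx (trans (sym (h (here refl))) bx))
... | no  bx | yes cx = ⊥-elim (bx (trans (h (here refl)) cx))

-- Permutations in one-line notation

InRange : ℕ → ℕ → Set
InRange n x = 1 ≤ x × x ≤ n

record IsPerm (n : ℕ) (w : List ℕ) : Set where
  field
    length≡ : length w ≡ n
    app-range : ∀ x → InRange n x → InRange n (app w x)
    app-injective : ∀ x y → InRange n x → InRange n y → app w x ≡ app w y → x ≡ y
open IsPerm public

inRange-nonZero : ∀ {n x} → InRange n x → NonZero x
inRange-nonZero = >-nonZero ∘ proj₁

inRange-length : ∀ {n w x} → IsPerm n w → InRange n x → InRange (length w) x
inRange-length {x = x} P = subst (λ l → InRange l x) (sym (length≡ P))

app∈ : ∀ w x → InRange (length w) x → app w x ∈ w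
app∈ (y ∷ w) 1             _            = here refl
app∈ (y ∷ w) (suc (suc x)) (_ , s≤s x≤) = there (app∈ w (suc x) (s≤s z≤n , x≤))

∈⇒app : ∀ w {y} → y ∈ w → ∃[ x ] (InRange (length w) x × app w x ≡ y)
∈⇒app (_ ∷ w) (here refl) = 1 , (s≤s z≤n , s≤s z≤n) , refl
∈⇒app (_ ∷ w) (there y∈) with ∈⇒app w y∈
... | suc x , (_ , x≤) , e = suc (suc x) , (s≤s z≤n , s≤s x≤) , e

app-map : ∀ (f : ℕ → ℕ) w x → InRange (length w) x → app (map f w) x ≡ f (app w x)
app-map f (_ ∷ w) 1             _            = refl
app-map f (_ ∷ w) (suc (suc x)) (_ , s≤s x≤) = app-map f w (suc x) (s≤s z≤n , x≤)

app-ext : ∀ w v → length w ≡ length v → (∀ x → InRange (length w) x → app w x ≡ app v x) → w ≡ v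
app-ext []      []      _ _ = refl
app-ext (x ∷ w) (y ∷ v) e h =
  cong₂ _∷_ (h 1 (s≤s z≤n , s≤s z≤n))
    (app-ext w v (suc-injective e) λ { (suc p) (_ , p≤) → h (suc (suc p)) (s≤s z≤n , s≤s p≤) })

range : ℕ → ℕ → List ℕ
range a zero    = []
range a (suc c) = a ∷ range (suc a) c

applyUpTo≡range : ∀ (f : ℕ → ℕ) a c → (∀ k → f k ≡ a + k) → applyUpTo f c ≡ range a c
applyUpTo≡range f a zero    _ = refl
applyUpTo≡range f a (suc c) h =
  cong₂ _∷_ (trans (h 0) (+-identityʳ a))
            (applyUpTo≡range (f ∘ suc) (suc a) c (λ k → trans (h (suc k)) (+-suc a k)))

map-+-upTo≡range : ∀ a c → map (a +_) (upTo c) ≡ range a c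
map-+-upTo≡range a c =
  trans (map-applyUpTo (λ k → k) (a +_) c) (applyUpTo≡range (a +_) a c (λ _ → refl))

range1≡range : ∀ n → range1 n ≡ range 1 n
range1≡range = map-+-upTo≡range 1

∈-range⁻ : ∀ a c {x} → x ∈ range a c → a ≤ x × x < a + c
∈-range⁻ a (suc c) (here refl) = ≤-refl , m<m+n a z<s
∈-range⁻ a (suc c) {x} (there x∈) with ∈-range⁻ (suc a) c x∈
... | a<x , x< = <⇒≤ a<x , subst (x <_) (sym (+-suc a c)) x<

∈-range⁺ : ∀ a c {x} → a ≤ x → x < a + c → x ∈ range a c
∈-range⁺ a zero    a≤x x< = ⊥-elim (<⇒≱ x< (subst (_≤ _) (sym (+-identityʳ a)) a≤x))
∈-range⁺ a (suc c) {x} a≤x x< with a ≟ x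
... | yes refl = here refl
... | no  a≢x  = there (∈-range⁺ (suc a) c (≤∧≢⇒< a≤x a≢x) (subst (x <_) (+-suc a c) x<))

∈-range1⁻ : ∀ n {x} → x ∈ range1 n → InRange n x
∈-range1⁻ n x∈ rewrite range1≡range n = let 1≤x , x< = ∈-range⁻ 1 n x∈ in 1≤x , s≤s⁻¹ x<

∈-range1⁺ : ∀ n {x} → InRange n x → x ∈ range1 n
∈-range1⁺ n (1≤x , x≤n) rewrite range1≡range n = ∈-range⁺ 1 n 1≤x (s≤s x≤n)

map-suc-range : ∀ a c → map suc (range a c) ≡ range (suc a) c
map-suc-range a zero    = refl
map-suc-range a (suc c) = cong (suc a ∷_) (map-suc-range (suc a) c)

length-tabulate : ∀ (f : ℕ → ℕ) n → length (map f (range1 n)) ≡ n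
length-tabulate f n = trans (length-map f (range1 n)) (trans (length-map suc (upTo n)) (length-upTo n))

app-map-range : ∀ (f : ℕ → ℕ) a c p → p < c → app (map f (range a c)) (suc p) ≡ f (a + p)
app-map-range f a (suc c) zero    _         = cong f (sym (+-identityʳ a))
app-map-range f a (suc c) (suc p) (s≤s p<c) =
  trans (app-map-range f (suc a) c p p<c) (cong f (sym (+-suc a p)))

app-tabulate : ∀ (f : ℕ → ℕ) n x → InRange n x → app (map f (range1 n)) x ≡ f x
app-tabulate f n (suc p) (_ , p<n) rewrite range1≡range n = app-map-range f 1 n p p<n

∈⇒memb≡true : ∀ {x xs} → x ∈ xs → memb x xs ≡ true
∈⇒memb≡true {x} x∈ = any-true⁺ _ x∈ (≡ᵇ-true x x refl)

∉⇒memb≡false : ∀ {x} xs → x ∉ xs → memb x xs ≡ false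
∉⇒memb≡false {x} xs x∉ = any-false⁺ _ xs λ {z} z∈ → ≡ᵇ-false x z λ { refl → x∉ z∈ }

AppInjective : List ℕ → Set
AppInjective w = ∀ x y → InRange (length w) x → InRange (length w) y → app w x ≡ app w y → x ≡ y

distinct⇒appInjective : ∀ w → distinct w ≡ true → AppInjective w
distinct⇒appInjective []      _ 1 _ (_ , ())
distinct⇒appInjective (a ∷ w) d = injective
  where
  a∉w : a ∉ w
  a∉w a∈w = false≢true (trans (sym (cong not (∈⇒memb≡true a∈w))) (∧-trueˡ d))
  ∈w : ∀ {x} → InRange (suc (length w)) (suc (suc x)) → app w (suc x) ∈ w
  ∈w (_ , s≤s x≤) = app∈ w _ (s≤s z≤n , x≤)
  injective : AppInjective (a ∷ w)
  injective 1             1             _  _  _ = refl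
  injective 1             (suc (suc y)) _  ry e = ⊥-elim (a∉w (subst (_∈ w) (sym e) (∈w ry)))
  injective (suc (suc x)) 1             rx _  e = ⊥-elim (a∉w (subst (_∈ w) e (∈w rx)))
  injective (suc (suc x)) (suc (suc y)) (_ , s≤s x≤) (_ , s≤s y≤) e = cong suc
    (distinct⇒appInjective w (∧-trueʳ {not (memb a w)} d) (suc x) (suc y) (s≤s z≤n , x≤) (s≤s z≤n , y≤) e)

appInjective⇒distinct : ∀ w → AppInjective w → distinct w ≡ true
appInjective⇒distinct []      _         = refl
appInjective⇒distinct (a ∷ w) injective =
  cong₂ _∧_ (cong not (∉⇒memb≡false w a∉w)) (appInjective⇒distinct w injective-tail)
  where
  a∉w : a ∉ w
  a∉w a∈w with ∈⇒app w a∈w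
  ... | suc y , (_ , y≤) , e with injective 1 (suc (suc y)) (s≤s z≤n , s≤s z≤n) (s≤s z≤n , s≤s y≤) (sym e)
  ... | ()
  injective-tail : AppInjective w
  injective-tail (suc x) (suc y) (_ , x≤) (_ , y≤) e =
    suc-injective (injective (suc (suc x)) (suc (suc y)) (s≤s z≤n , s≤s x≤) (s≤s z≤n , s≤s y≤) e)

∈-wordsOver⁻ : ∀ as m {w} → w ∈ wordsOver as m → length w ≡ m × (∀ {x} → x ∈ w → x ∈ as)
∈-wordsOver⁻ as zero    (here refl) = refl , λ ()
∈-wordsOver⁻ as (suc m) w∈ with find (∈-concatMap⁻ (λ v → map (_∷ v) as) {xs = wordsOver as m} w∈)
... | v , v∈ , w∈′ with ∈-map⁻ (_∷ v) w∈′
... | a , a∈ , refl with ∈-wordsOver⁻ as m v∈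
... | length-v , v⊆as = cong suc length-v , λ { (here refl) → a∈ ; (there x∈) → v⊆as x∈ }

∈-wordsOver⁺ : ∀ as m w → length w ≡ m → (∀ {x} → x ∈ w → x ∈ as) → w ∈ wordsOver as m
∈-wordsOver⁺ as zero    []      _ _ = here refl
∈-wordsOver⁺ as (suc m) (a ∷ v) e w⊆as =
  ∈-concatMap⁺ (λ u → map (_∷ u) as) {xs = wordsOver as m}
    (lose (∈-wordsOver⁺ as m v (suc-injective e) (w⊆as ∘ there)) (∈-map⁺ (_∷ v) (w⊆as (here refl))))

∈-perms⁻ : ∀ n {w} → w ∈ perms n → IsPerm n w
∈-perms⁻ n {w} w∈ with ∈-filter⁻ (λ v → distinct v Data.Bool.≟ true) {xs = wordsOver (range1 n) n} w∈
... | w∈words , d with ∈-wordsOver⁻ (range1 n) n w∈words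
... | length-w , w⊆range = record
  { length≡       = length-w
  ; app-range     = λ x r → ∈-range1⁻ n (w⊆range (app∈ w x (toLength r)))
  ; app-injective = λ x y rx ry → distinct⇒appInjective w d x y (toLength rx) (toLength ry)
  }
  where
  toLength : ∀ {x} → InRange n x → InRange (length w) x
  toLength {x} = subst (λ l → InRange l x) (sym length-w)

∈-perms⁺ : ∀ n {w} → IsPerm n w → w ∈ perms n
∈-perms⁺ n {w} P = ∈-filter⁺ (λ v → distinct v Data.Bool.≟ true)
  (∈-wordsOver⁺ (range1 n) n w (length≡ P) w⊆range)
  (appInjective⇒distinct w λ x y rx ry → app-injective P x y (fromLength rx) (fromLength ry))
  where
  fromLength : ∀ {x} → InRange (length w) x → InRange n x
  fromLength {x} = subst (λ l → InRange l x) (length≡ P)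
  w⊆range : ∀ {x} → x ∈ w → x ∈ range1 n
  w⊆range x∈ with ∈⇒app w x∈
  ... | p , r , refl = ∈-range1⁺ n (app-range P p (fromLength r))

concatMap-unique : ∀ {A B : Set} (g : A → List B) {L} → Unique L → (∀ v → Unique (g v)) →
  (∀ {v v′ z} → z ∈ g v → z ∈ g v′ → v ≡ v′) → Unique (concatMap g L)
concatMap-unique g {[]}    _          _   _        = []
concatMap-unique g {v ∷ L} (v∉L ∷ uL) ugv disjoint =
  Unique.++⁺ (ugv v) (concatMap-unique g uL ugv disjoint) apart
  where
  apart : ∀ {z} → ¬ (z ∈ g v × z ∈ concatMap g L)
  apart (z∈gv , z∈rest) with find (∈-concatMap⁻ g {xs = L} z∈rest)
  ... | v′ , v′∈L , z∈gv′ = All.lookup v∉L v′∈L (disjoint z∈gv z∈gv′)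

wordsOver-unique : ∀ as m → Unique as → Unique (wordsOver as m)
wordsOver-unique as zero    _   = All.[] ∷ []
wordsOver-unique as (suc m) uas = concatMap-unique (λ v → map (_∷ v) as) (wordsOver-unique as m uas)
  (λ _ → Unique.map⁺ (proj₁ ∘ ∷-injective) uas) same-tail
  where
  same-tail : ∀ {v v′ z} → z ∈ map (_∷ v) as → z ∈ map (_∷ v′) as → v ≡ v′
  same-tail z∈ z∈′ with ∈-map⁻ (_∷ _) z∈ | ∈-map⁻ (_∷ _) z∈′
  ... | _ , _ , refl | _ , _ , e = proj₂ (∷-injective e)

perms-unique : ∀ n → Unique (perms n)
perms-unique n = Unique.filter⁺ (λ v → distinct v Data.Bool.≟ true)
  (wordsOver-unique (range1 n) n (Unique.map⁺ suc-injective (Unique.upTo⁺ n)))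

-- Orbits and the standard cycle form

iter : List ℕ → ℕ → ℕ → ℕ
iter w zero    x = x
iter w (suc k) x = app w (iter w k x)

iter-app : ∀ w k x → iter w k (app w x) ≡ iter w (suc k) x
iter-app w zero    x = refl
iter-app w (suc k) x = cong (app w) (iter-app w k x)

iter-+ : ∀ w a b x → iter w a (iter w b x) ≡ iter w (a + b) x
iter-+ w zero    b x = refl
iter-+ w (suc a) b x = cong (app w) (iter-+ w a b x)

module _ {n w} (P : IsPerm n w) where

  iter-range : ∀ k {x} → InRange n x → InRange n (iter w k x)
  iter-range zero    r = r
  iter-range (suc k) r = app-range P _ (iter-range k r)

  iter-cancel : ∀ {x} → InRange n x → ∀ a d → iter w a x ≡ iter w (a + d) x → x ≡ iter w d x
  iter-cancel r zero    d e = e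
  iter-cancel r (suc a) d e =
    iter-cancel r a d (app-injective P _ _ (iter-range a r) (iter-range (a + d) r) e)

  -- Pigeonhole on x, w x, …, wⁿ x, then cancel the common prefix.
  iter-returns : ∀ {x} → InRange n x → ∃[ K ] (1 ≤ K × K ≤ n × iter w K x ≡ x)
  iter-returns {x} r with Fin.pigeonhole (n<1+n n) orbit
    where
    orbit : Fin (suc n) → Fin n
    orbit k = fromℕ< (pred<n (iter-range (toℕ k) r))
      where
      pred<n : ∀ {v} → InRange n v → pred v < n
      pred<n {suc v} (_ , v<n) = v<n
  ... | a , b , a<b , same = toℕ b ∸ toℕ a , m<n⇒0<n∸m a<b , d≤n , sym (iter-cancel r (toℕ a) _ loop)
    where
    d≤n : toℕ b ∸ toℕ a ≤ n
    d≤n = ≤-trans (m∸n≤m (toℕ b) (toℕ a)) (s≤s⁻¹ (Fin.toℕ<n b))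
    loop : iter w (toℕ a) x ≡ iter w (toℕ a + (toℕ b ∸ toℕ a)) x
    loop = trans
      (pred-injective {{inRange-nonZero (iter-range (toℕ a) r)}} {{inRange-nonZero (iter-range (toℕ b) r)}}
        (trans (sym (Fin.toℕ-fromℕ< _)) (trans (cong toℕ same) (Fin.toℕ-fromℕ< _))))
      (cong (λ k → iter w k x) (sym (m+[n∸m]≡n (<⇒≤ a<b))))

  iter-invertible : ∀ {y} → InRange n y → ∀ k → ∃[ b ] (iter w b (iter w k y) ≡ y)
  iter-invertible r zero = 0 , refl
  iter-invertible {y} r (suc k) with iter-invertible r k
  ... | suc b , e = b , trans (iter-app w b (iter w k y)) e
  ... | zero  , e with iter-returns r
  ... | suc K , _ , _ , eK = K , trans (cong (λ z → iter w K (app w z)) e) (trans (iter-app w K y) eK)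

-- The loop `go` local to cycleFrom, given a name: the meta is solved by unification with its body.
mutual
  walk : List ℕ → ℕ → ℕ → ℕ → List ℕ
  walk = _

  cycleFrom≡walk : ∀ w t → cycleFrom w t ≡ walk w t (length w) (app w t)
  cycleFrom≡walk w t with length w | app w t
  ... | f | j = refl

HitsWithin : List ℕ → ℕ → ℕ → ℕ → Set
HitsWithin w t f j = ∃[ k ] (k < f × iter w k j ≡ t)

hitsWithin-app : ∀ {w t f j} → j ≢ t → HitsWithin w t (suc f) j → HitsWithin w t f (app w j)
hitsWithin-app j≢t (zero  , _ , e)        = ⊥-elim (j≢t e)
hitsWithin-app j≢t (suc k , s≤s k<f , e) = k , k<f , trans (iter-app _ k _) e

cycle-closes : ∀ {n w} → IsPerm n w → ∀ {x} → InRange n x → HitsWithin w x n (app w x)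
cycle-closes P r with iter-returns P r
... | suc K , _ , K<n , e = K , K<n , trans (iter-app _ K _) e

walk-fuel : ∀ w t f j → HitsWithin w t f j → ∀ d → walk w t (d + f) j ≡ walk w t f j
walk-fuel w t zero    j (_ , () , _)
walk-fuel w t (suc f) j hits d rewrite +-suc d f with j ≟ t
... | yes j≡t = trans (if-true (≡ᵇ-true j t j≡t)) (sym (if-true (≡ᵇ-true j t j≡t)))
... | no  j≢t = trans (if-false (≡ᵇ-false j t j≢t))
  (trans (cong (j ∷_) (walk-fuel w t f (app w j) (hitsWithin-app j≢t hits) d))
         (sym (if-false (≡ᵇ-false j t j≢t))))

∈-walk⇒iter : ∀ w t f j {z} → z ∈ walk w t f j → ∃[ k ] (z ≡ iter w k j)
∈-walk⇒iter w t (suc f) j z∈ with j ≡ᵇ t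
∈-walk⇒iter w t (suc f) j (here refl) | false = 0 , refl
∈-walk⇒iter w t (suc f) j (there z∈)  | false with ∈-walk⇒iter w t f (app w j) z∈
... | k , e = suc k , trans e (iter-app w k j)

∈-cycleOf⇒iter : ∀ w c {z} → z ∈ cycleOf w c → ∃[ k ] (z ≡ iter w k c)
∈-cycleOf⇒iter w c (here refl) = 0 , refl
∈-cycleOf⇒iter w c (there z∈) rewrite cycleFrom≡walk w c
  with ∈-walk⇒iter w c (length w) (app w c) z∈
... | k , e = suc k , trans e (iter-app w k c)

walk-start : ∀ w t f j → HitsWithin w t f j → j ≡ t ⊎ j ∈ walk w t f j
walk-start w t zero    j (_ , () , _)
walk-start w t (suc f) j _ with j ≟ t
... | yes j≡t = inj₁ j≡t
... | no  j≢t rewrite ≡ᵇ-false j t j≢t = inj₂ (here refl)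

walk-closed : ∀ w t f j → HitsWithin w t f j →
  ∀ {z} → z ∈ walk w t f j → app w z ≡ t ⊎ app w z ∈ walk w t f j
walk-closed w t (suc f) j hits z∈ with j ≟ t
... | yes j≡t rewrite ≡ᵇ-true j t j≡t with z∈
...   | ()
walk-closed w t (suc f) j hits z∈ | no j≢t rewrite ≡ᵇ-false j t j≢t with z∈
...   | here refl = Sum.map₂ there (walk-start w t f (app w j) (hitsWithin-app j≢t hits))
...   | there z∈′ = Sum.map₂ there (walk-closed w t f (app w j) (hitsWithin-app j≢t hits) z∈′)

iter∈cycleOf : ∀ {n w} → IsPerm n w → ∀ {c} → InRange n c → ∀ k → iter w k c ∈ cycleOf w c
iter∈cycleOf P r zero = here refl
iter∈cycleOf {n} {w} P {c} r (suc k) = closed (iter∈cycleOf P r k)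
  where
  hits : HitsWithin w c (length w) (app w c)
  hits = subst (λ l → HitsWithin w c l (app w c)) (sym (length≡ P)) (cycle-closes P r)
  back-to-c : ∀ {z} → z ≡ c ⊎ z ∈ walk w c (length w) (app w c) → z ∈ cycleOf w c
  back-to-c (inj₁ refl) = here refl
  back-to-c (inj₂ z∈) rewrite cycleFrom≡walk w c = there z∈
  closed : ∀ {z} → z ∈ cycleOf w c → app w z ∈ cycleOf w c
  closed (here refl) = back-to-c (walk-start w c (length w) (app w c) hits)
  closed (there z∈) rewrite cycleFrom≡walk w c = back-to-c (walk-closed w c (length w) (app w c) hits z∈)

isCycleMin⇒≤iter : ∀ {n w} → IsPerm n w → ∀ {y} → InRange n y → isCycleMin w y ≡ true → ∀ k → y ≤ iter w k y
isCycleMin⇒≤iter P {y} r e k = ≤ᵇ-true⁻ y _ (all-true⁻ (y ≤ᵇ_) e (iter∈cycleOf P r k))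

≤iter⇒isCycleMin : ∀ w y → (∀ k → y ≤ iter w k y) → isCycleMin w y ≡ true
≤iter⇒isCycleMin w y h = all-true⁺ (y ≤ᵇ_) (cycleOf w y) (≤ᵇ-iter ∘ ∈-cycleOf⇒iter w y)
  where
  ≤ᵇ-iter : ∀ {z} → ∃[ k ] (z ≡ iter w k y) → (y ≤ᵇ z) ≡ true
  ≤ᵇ-iter (k , refl) = ≤ᵇ-true y _ (h k)

¬isCycleMin⇒iter< : ∀ w y → isCycleMin w y ≡ false → ∃[ k ] (iter w k y < y)
¬isCycleMin⇒iter< w y e with all-false⁻ (y ≤ᵇ_) (cycleOf w y) e
... | z , z∈ , y≰z with ∈-cycleOf⇒iter w y z∈
... | k , refl = k , ≰⇒> (λ y≤ → false≢true (trans (sym y≰z) (≤ᵇ-true y _ y≤)))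

∈-cycleLeaders⁻ : ∀ {m w c} → IsPerm m w → c ∈ cycleLeaders w → InRange m c × isCycleMin w c ≡ true
∈-cycleLeaders⁻ {w = w} P c∈ with ∈-filter⁻ (true? (isCycleMin w)) c∈
... | c∈range , c-min = subst (λ l → InRange l _) (length≡ P) (∈-range1⁻ _ c∈range) , c-min

laterLeaders : List ℕ → ℕ → List ℕ
laterLeaders w m = filter (true? (isCycleMin w)) (range 2 (m ∸ 1))

∈-laterLeaders⁻ : ∀ {w m c} → 1 ≤ m → c ∈ laterLeaders w m → (2 ≤ c × c ≤ m) × isCycleMin w c ≡ true
∈-laterLeaders⁻ {w} {suc m} _ c∈ with ∈-filter⁻ (true? (isCycleMin w)) {xs = range 2 m} c∈
... | c∈range , c-min = Product.map₂ s≤s⁻¹ (∈-range⁻ 2 m c∈range) , c-min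

cycleLeaders-laterLeaders : ∀ {m w} → IsPerm m w → 1 ≤ m → cycleLeaders w ≡ 1 ∷ laterLeaders w m
cycleLeaders-laterLeaders {suc m} {w} P 1≤m = begin
  filter (true? (isCycleMin w)) (range1 (length w))
    ≡⟨ cong (filter (true? (isCycleMin w)) ∘ range1) (length≡ P) ⟩
  filter (true? (isCycleMin w)) (range1 (suc m))
    ≡⟨ cong (filter (true? (isCycleMin w))) (range1≡range (suc m)) ⟩
  filter (true? (isCycleMin w)) (range 1 (suc m))
    ≡⟨ filter-accept (true? (isCycleMin w)) 1-isCycleMin ⟩
  1 ∷ laterLeaders w (suc m) ∎
  where
  open ≡-Reasoning
  1-isCycleMin : isCycleMin w 1 ≡ true
  1-isCycleMin = ≤iter⇒isCycleMin w 1 (λ k → proj₁ (iter-range P k (s≤s z≤n , 1≤m)))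

cycleFrom-1 : ∀ {m w} → IsPerm m w → 1 ≤ m → app w 1 ≢ 1 → ∃[ rest ] (cycleFrom w 1 ≡ app w 1 ∷ rest)
cycleFrom-1 {suc m} {w} P _ w1≢1 rewrite cycleFrom≡walk w 1 | length≡ P =
  _ , if-false (≡ᵇ-false (app w 1) 1 w1≢1)

module _ {m w} (P : IsPerm m w) (1≤m : 1 ≤ m) where

  flat-laterLeaders : flat w ≡ 1 ∷ cycleFrom w 1 ++ concat (map (cycleOf w) (laterLeaders w m))
  flat-laterLeaders rewrite cycleLeaders-laterLeaders P 1≤m = refl

  μ-laterLeaders : μ w ≡ suc (length (laterLeaders w m))
  μ-laterLeaders rewrite cycleLeaders-laterLeaders P 1≤m = cong suc (length-map (cycleOf w) (laterLeaders w m))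

  second-flat : app w 1 ≢ 1 → second (flat w) ≡ app w 1
  second-flat w1≢1 rewrite flat-laterLeaders | proj₂ (cycleFrom-1 P 1≤m w1≢1) = refl

  leaderOf : ∀ {y} → InRange m y → Acc _<_ y →
    ∃[ c ] (InRange m c × isCycleMin w c ≡ true × ∃[ b ] (iter w b c ≡ y))
  leaderOf {y} r (acc smaller) with isCycleMin w y in e
  ... | true  = y , r , e , 0 , refl
  ... | false with ¬isCycleMin⇒iter< w y e
  ... | k , wᵏy<y with leaderOf (iter-range P k r) (smaller wᵏy<y)
  ... | c , rc , c-min , b , wᵇc≡wᵏy with iter-invertible P r k
  ... | b′ , e′ = c , rc , c-min , b′ + b , trans (sym (iter-+ w b′ b c)) (trans (cong (iter w b′) wᵇc≡wᵏy) e′)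

  ∈-flat : ∀ {y} → InRange m y → y ∈ flat w
  ∈-flat r with leaderOf r (<-wellFounded _)
  ... | c , rc , c-min , b , refl = ∈-concat⁺′ (iter∈cycleOf P rc b)
    (∈-map⁺ (cycleOf w) (∈-filter⁺ (true? (isCycleMin w)) (∈-range1⁺ _ (inRange-length P rc)) c-min))

  flat-range : ∀ {z} → z ∈ flat w → InRange m z
  flat-range z∈ with ∈-concat⁻′ (map (cycleOf w) (cycleLeaders w)) z∈
  ... | v , z∈v , v∈ with ∈-map⁻ (cycleOf w) v∈
  ... | c , c∈ , refl with ∈-cycleOf⇒iter w c z∈v
  ... | k , refl = iter-range P k (proj₁ (∈-cycleLeaders⁻ P c∈))

isDerangement⁻ : ∀ w → isDerangement w ≡ true → ∀ x → InRange (length w) x → app w x ≢ x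
isDerangement⁻ w e x r wx≡x =
  false≢true (trans (sym (cong not (≡ᵇ-true _ _ wx≡x))) (all-true⁻ _ e (∈-range1⁺ _ r)))

isDerangement⁺ : ∀ w → (∀ x → InRange (length w) x → app w x ≢ x) → isDerangement w ≡ true
isDerangement⁺ w h =
  all-true⁺ _ (range1 (length w)) λ {x} x∈ → cong not (≡ᵇ-false _ _ (h x (∈-range1⁻ _ x∈)))

-- Renumbering around a value i

punchIn : ℕ → ℕ → ℕ
punchIn i x = if x <ᵇ i then x else suc x

punchOut : ℕ → ℕ → ℕ
punchOut i y = if y <ᵇ i then y else pred y

module _ (i : ℕ) where

  punchIn-< : ∀ {x} → x < i → punchIn i x ≡ x
  punchIn-< x<i = if-true (<ᵇ-true _ i x<i)

  punchIn-≥ : ∀ {x} → i ≤ x → punchIn i x ≡ suc x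
  punchIn-≥ i≤x = if-false (<ᵇ-false _ i (≤⇒≯ i≤x))

  punchOut-< : ∀ {y} → y < i → punchOut i y ≡ y
  punchOut-< y<i = if-true (<ᵇ-true _ i y<i)

  punchOut-≥ : ∀ {y} → i ≤ y → punchOut i y ≡ pred y
  punchOut-≥ i≤y = if-false (<ᵇ-false _ i (≤⇒≯ i≤y))

  punchIn≢ : ∀ x → punchIn i x ≢ i
  punchIn≢ x e with x <? i
  ... | yes x<i = <-irrefl (trans (sym (punchIn-< x<i)) e) x<i
  ... | no  x≮i = <-irrefl (trans (sym e) (punchIn-≥ (≮⇒≥ x≮i))) (s≤s (≮⇒≥ x≮i))

  punchOut-punchIn : ∀ x → punchOut i (punchIn i x) ≡ x
  punchOut-punchIn x with x <? i
  ... | yes x<i = trans (cong (punchOut i) (punchIn-< x<i)) (punchOut-< x<i)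
  ... | no  x≮i =
    trans (cong (punchOut i) (punchIn-≥ (≮⇒≥ x≮i))) (punchOut-≥ (m≤n⇒m≤1+n (≮⇒≥ x≮i)))

  punchIn-punchOut : ∀ {y} → y ≢ i → punchIn i (punchOut i y) ≡ y
  punchIn-punchOut {y} y≢i with y <? i
  ... | yes y<i = trans (cong (punchIn i) (punchOut-< y<i)) (punchIn-< y<i)
  punchIn-punchOut {zero}  y≢i | no y≮i = ⊥-elim (y≢i (sym (n≤0⇒n≡0 (≮⇒≥ y≮i))))
  punchIn-punchOut {suc y} y≢i | no y≮i =
    trans (cong (punchIn i) (punchOut-≥ (≮⇒≥ y≮i))) (punchIn-≥ (s≤s⁻¹ (≤∧≢⇒< (≮⇒≥ y≮i) (y≢i ∘ sym))))

  punchIn-injective : ∀ {x y} → punchIn i x ≡ punchIn i y → x ≡ y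
  punchIn-injective {x} {y} e =
    trans (sym (punchOut-punchIn x)) (trans (cong (punchOut i) e) (punchOut-punchIn y))

  punchOut-injective : ∀ {x y} → x ≢ i → y ≢ i → punchOut i x ≡ punchOut i y → x ≡ y
  punchOut-injective x≢i y≢i e =
    trans (sym (punchIn-punchOut x≢i)) (trans (cong (punchIn i) e) (punchIn-punchOut y≢i))

  punchIn-mono-< : ∀ {a b} → a < b → punchIn i a < punchIn i b
  punchIn-mono-< {a} {b} a<b with a <? i | b <? i
  ... | yes a<i | yes b<i rewrite punchIn-< a<i | punchIn-< b<i = a<b
  ... | yes a<i | no  b≮i rewrite punchIn-< a<i | punchIn-≥ (≮⇒≥ b≮i) = m≤n⇒m≤1+n a<b
  ... | no  a≮i | yes b<i = ⊥-elim (a≮i (<-trans a<b b<i))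
  ... | no  a≮i | no  b≮i rewrite punchIn-≥ (≮⇒≥ a≮i) | punchIn-≥ (≮⇒≥ b≮i) = s≤s a<b

  punchIn-mono-≤ : ∀ {a b} → a ≤ b → punchIn i a ≤ punchIn i b
  punchIn-mono-≤ a≤b with m≤n⇒m<n∨m≡n a≤b
  ... | inj₁ a<b  = <⇒≤ (punchIn-mono-< a<b)
  ... | inj₂ refl = ≤-refl

  punchIn-cancel-≤ : ∀ {a b} → punchIn i a ≤ punchIn i b → a ≤ b
  punchIn-cancel-≤ le = ≮⇒≥ λ b<a → <⇒≱ (punchIn-mono-< b<a) le

  punchIn-cancel-< : ∀ {a b} → punchIn i a < punchIn i b → a < b
  punchIn-cancel-< lt = ≰⇒> λ b≤a → <⇒≱ lt (punchIn-mono-≤ b≤a)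

  punchIn-<ᵇ : ∀ a b → (punchIn i a <ᵇ punchIn i b) ≡ (a <ᵇ b)
  punchIn-<ᵇ a b with a <? b
  ... | yes a<b = trans (<ᵇ-true _ _ (punchIn-mono-< a<b)) (sym (<ᵇ-true _ _ a<b))
  ... | no  a≮b = trans (<ᵇ-false _ _ (a≮b ∘ punchIn-cancel-<)) (sym (<ᵇ-false _ _ a≮b))

  punchIn-1 : 2 ≤ i → punchIn i 1 ≡ 1
  punchIn-1 = punchIn-<

  punchIn≡1⇒ : 2 ≤ i → ∀ {x} → punchIn i x ≡ 1 → x ≡ 1
  punchIn≡1⇒ 2≤i e = punchIn-injective (trans e (sym (punchIn-1 2≤i)))

  punchIn-range : ∀ {m x} → i ≤ suc m → InRange m x → InRange (suc m) (punchIn i x)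
  punchIn-range {x = x} i≤ (1≤x , x≤m) with x <? i
  ... | yes x<i rewrite punchIn-< x<i = 1≤x , m≤n⇒m≤1+n x≤m
  ... | no  x≮i rewrite punchIn-≥ (≮⇒≥ x≮i) = s≤s z≤n , s≤s x≤m

  punchOut-range : ∀ {m y} → 2 ≤ i → i ≤ suc m → InRange (suc m) y → y ≢ i → InRange m (punchOut i y)
  punchOut-range {y = y} 2≤i i≤ (1≤y , y≤) y≢i with y <? i
  ... | yes y<i rewrite punchOut-< y<i = 1≤y , s≤s⁻¹ (≤-trans y<i i≤)
  ... | no  y≮i rewrite punchOut-≥ (≮⇒≥ y≮i) = pred-mono-≤ (≤-trans 2≤i (≮⇒≥ y≮i)) , pred-mono-≤ y≤

  punchOut≢1 : 2 ≤ i → ∀ {y} → y ≢ 1 → y ≢ i → punchOut i y ≢ 1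
  punchOut≢1 2≤i {y} y≢1 y≢i e with y <? i
  ... | yes y<i = y≢1 (trans (sym (punchOut-< y<i)) e)
  ... | no  y≮i = <⇒≢ (pred-mono-≤ (≤-trans (s≤s 2≤i) i<y)) (sym (trans (sym (punchOut-≥ (<⇒≤ i<y))) e))
    where
    i<y : i < y
    i<y = ≤∧≢⇒< (≮⇒≥ y≮i) (y≢i ∘ sym)

  map-punchIn-range : ∀ a c → i ≤ a → map (punchIn i) (range a c) ≡ range (suc a) c
  map-punchIn-range a zero    _   = refl
  map-punchIn-range a (suc c) i≤a =
    cong₂ _∷_ (punchIn-≥ i≤a) (map-punchIn-range (suc a) c (m≤n⇒m≤1+n i≤a))

  filter-range-punchIn : ∀ (b : ℕ → Bool) a c → a ≤ i → i ≤ a + c → b i ≡ false →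
    filter (true? b) (range a (suc c)) ≡ filter (true? b) (map (punchIn i) (range a c))
  filter-range-punchIn b a c a≤i i≤ bi with a ≟ i
  ... | yes refl = trans (filter-reject (true? b) (false≢true ∘ trans (sym bi)))
                         (cong (filter (true? b)) (sym (map-punchIn-range a c ≤-refl)))
  ... | no  a≢i with c
  ...   | zero   = ⊥-elim (a≢i (≤-antisym a≤i (subst (i ≤_) (+-identityʳ a) i≤)))
  ...   | suc c′ rewrite punchIn-< (≤∧≢⇒< a≤i a≢i) = filter-∷-cong (true? b) a
    (filter-range-punchIn b (suc a) c′ (≤∧≢⇒< a≤i a≢i) (subst (i ≤_) (+-suc a c′) i≤) bi)

-- The pattern 21-3

contains21-3-map : ∀ (f : ℕ → ℕ) → (∀ a b → (f a <ᵇ f b) ≡ (a <ᵇ b)) →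
  ∀ w → contains21-3 (map f w) ≡ contains21-3 w
contains21-3-map f h []          = refl
contains21-3-map f h (a ∷ [])    = refl
contains21-3-map f h (a ∷ b ∷ r) = cong₂ _∨_
  (cong₂ _∧_ (h b a) (cong or (trans (sym (map-∘ r)) (map-cong (h a) r))))
  (contains21-3-map f h (b ∷ r))

contains21-3-1∷ : ∀ {b} r → 1 ≤ b → contains21-3 (1 ∷ b ∷ r) ≡ contains21-3 (b ∷ r)
contains21-3-1∷ {suc b} r _ = refl

-- Apart from the occurrences in a ∷ w, an occurrence of 21-3 can only start with the letter i.
contains21-3-insert : ∀ i a w → 1 ≤ i → contains21-3 (1 ∷ i ∷ map (punchIn i) (a ∷ w)) ≡
  ((punchIn i a <ᵇ i) ∧ any (i <ᵇ_) (map (punchIn i) w)) ∨ contains21-3 (a ∷ w)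
contains21-3-insert i a w 1≤i = trans (contains21-3-1∷ (map (punchIn i) (a ∷ w)) 1≤i)
  (cong (((punchIn i a <ᵇ i) ∧ any (i <ᵇ_) (map (punchIn i) w)) ∨_)
        (contains21-3-map (punchIn i) (punchIn-<ᵇ i) (a ∷ w)))

contains21-3-insert-≤ : ∀ i a w → 1 ≤ i → i ≤ a →
  contains21-3 (1 ∷ i ∷ map (punchIn i) (a ∷ w)) ≡ contains21-3 (a ∷ w)
contains21-3-insert-≤ i a w 1≤i i≤a = begin
  contains21-3 (1 ∷ i ∷ map (punchIn i) (a ∷ w))
    ≡⟨ contains21-3-insert i a w 1≤i ⟩
  ((punchIn i a <ᵇ i) ∧ any (i <ᵇ_) (map (punchIn i) w)) ∨ contains21-3 (a ∷ w)
    ≡⟨ cong (λ b → (b ∧ any (i <ᵇ_) (map (punchIn i) w)) ∨ contains21-3 (a ∷ w)) no-descent ⟩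
  contains21-3 (a ∷ w) ∎
  where
  open ≡-Reasoning
  no-descent : (punchIn i a <ᵇ i) ≡ false
  no-descent = <ᵇ-false _ i λ lt → <⇒≱ lt (subst (i ≤_) (sym (punchIn-≥ i i≤a)) (m≤n⇒m≤1+n i≤a))

contains21-3-insert-max : ∀ i a w → 1 ≤ i → (∀ {c} → c ∈ w → c < i) →
  contains21-3 (1 ∷ i ∷ map (punchIn i) (a ∷ w)) ≡ contains21-3 (a ∷ w)
contains21-3-insert-max i a w 1≤i w<i = begin
  contains21-3 (1 ∷ i ∷ map (punchIn i) (a ∷ w))
    ≡⟨ contains21-3-insert i a w 1≤i ⟩
  ((punchIn i a <ᵇ i) ∧ any (i <ᵇ_) (map (punchIn i) w)) ∨ contains21-3 (a ∷ w)
    ≡⟨ cong (λ b → ((punchIn i a <ᵇ i) ∧ b) ∨ contains21-3 (a ∷ w)) nothing-above ⟩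
  ((punchIn i a <ᵇ i) ∧ false) ∨ contains21-3 (a ∷ w)
    ≡⟨ cong (_∨ contains21-3 (a ∷ w)) (∧-zeroʳ (punchIn i a <ᵇ i)) ⟩
  contains21-3 (a ∷ w) ∎
  where
  open ≡-Reasoning
  nothing-above : any (i <ᵇ_) (map (punchIn i) w) ≡ false
  nothing-above = any-false⁺ _ (map (punchIn i) w) λ z∈ →
    let c , c∈ , e = ∈-map⁻ (punchIn i) z∈
    in <ᵇ-false i _ (λ lt → <-asym (w<i c∈) (subst (i <_) (trans e (punchIn-< i (w<i c∈))) lt))

contains21-3-insert-true : ∀ i a w {c} → 1 ≤ i → a < i → c ∈ w → i ≤ c →
  contains21-3 (1 ∷ i ∷ map (punchIn i) (a ∷ w)) ≡ true
contains21-3-insert-true i a w {c} 1≤i a<i c∈ i≤c = begin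
  contains21-3 (1 ∷ i ∷ map (punchIn i) (a ∷ w))
    ≡⟨ contains21-3-insert i a w 1≤i ⟩
  ((punchIn i a <ᵇ i) ∧ any (i <ᵇ_) (map (punchIn i) w)) ∨ contains21-3 (a ∷ w)
    ≡⟨ cong (_∨ contains21-3 (a ∷ w)) (cong₂ _∧_ descent above) ⟩
  true ∎
  where
  open ≡-Reasoning
  descent : (punchIn i a <ᵇ i) ≡ true
  descent = <ᵇ-true _ i (subst (_< i) (sym (punchIn-< i a<i)) a<i)
  above : any (i <ᵇ_) (map (punchIn i) w) ≡ true
  above = any-true⁺ _ (∈-map⁺ (punchIn i) c∈) (<ᵇ-true i _ (subst (i <_) (sym (punchIn-≥ i i≤c)) (s≤s i≤c)))

-- Inserting i after 1 in the cycle of 1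

-- expand i is a bijection [1, m] → [2, m+1] sending 1 to i; collapse i is its inverse.
expand : ℕ → ℕ → ℕ
expand i x = if x ≡ᵇ 1 then i else punchIn i x

collapse : ℕ → ℕ → ℕ
collapse i p = if p ≡ᵇ i then 1 else punchOut i p

-- In cycle notation: renumber σ by punchIn i, then put i right after 1 in the cycle of 1.
insertAfter1 : ℕ → List ℕ → List ℕ
insertAfter1 i σ =
  map (λ p → if p ≡ᵇ 1 then i else punchIn i (app σ (collapse i p))) (range1 (suc (length σ)))

removeAfter1 : ℕ → List ℕ → List ℕ
removeAfter1 i π = map (λ x → punchOut i (app π (expand i x))) (range1 (pred (length π)))

module _ {i : ℕ} (2≤i : 2 ≤ i) where

  i≢1 : i ≢ 1
  i≢1 refl = <-irrefl refl 2≤i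

  expand-≢1 : ∀ {x} → x ≢ 1 → expand i x ≡ punchIn i x
  expand-≢1 {x} x≢1 = if-false (≡ᵇ-false x 1 x≢1)

  collapse-expand : ∀ x → collapse i (expand i x) ≡ x
  collapse-expand x with x ≟ 1
  ... | yes refl = if-true (≡ᵇ-true i i refl)
  ... | no  x≢1 rewrite expand-≢1 x≢1 =
    trans (if-false (≡ᵇ-false _ i (punchIn≢ i x))) (punchOut-punchIn i x)

  expand-collapse : ∀ {p} → p ≢ 1 → expand i (collapse i p) ≡ p
  expand-collapse {p} p≢1 with p ≟ i
  ... | yes refl rewrite ≡ᵇ-true i i refl = refl
  ... | no  p≢i rewrite ≡ᵇ-false p i p≢i =
    trans (expand-≢1 (punchOut≢1 i 2≤i p≢1 p≢i)) (punchIn-punchOut i p≢i)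

  expand≢1 : ∀ x → expand i x ≢ 1
  expand≢1 x with x ≟ 1
  ... | yes refl = i≢1
  ... | no  x≢1 rewrite expand-≢1 x≢1 = x≢1 ∘ punchIn≡1⇒ i 2≤i

  module _ {m : ℕ} (i≤ : i ≤ suc m) where

    private
      1≤m : 1 ≤ m
      1≤m = s≤s⁻¹ (≤-trans 2≤i i≤)

      1-range : InRange m 1
      1-range = s≤s z≤n , 1≤m

    i-range : InRange (suc m) i
    i-range = ≤-trans (s≤s z≤n) 2≤i , i≤

    expand-range : ∀ {x} → InRange m x → InRange (suc m) (expand i x)
    expand-range {x} r with x ≟ 1
    ... | yes refl = i-range
    ... | no  x≢1 rewrite expand-≢1 x≢1 = punchIn-range i i≤ r

    collapse-range : ∀ {p} → InRange (suc m) p → p ≢ 1 → InRange m (collapse i p)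
    collapse-range {p} r p≢1 with p ≟ i
    ... | yes refl rewrite ≡ᵇ-true i i refl = 1-range
    ... | no  p≢i rewrite ≡ᵇ-false p i p≢i = punchOut-range i 2≤i i≤ r p≢i

    module _ {σ : List ℕ} (P : IsPerm m σ) where

      private
        π = insertAfter1 i σ
        image : ℕ → ℕ
        image p = if p ≡ᵇ 1 then i else punchIn i (app σ (collapse i p))

      length-insertAfter1 : length π ≡ suc m
      length-insertAfter1 = trans (length-tabulate _ (suc (length σ))) (cong suc (length≡ P))

      app-insertAfter1-1 : app π 1 ≡ i
      app-insertAfter1-1 = app-tabulate image (suc (length σ)) 1 (s≤s z≤n , s≤s z≤n)

      app-insertAfter1-≢1 : ∀ {p} → InRange (suc m) p → p ≢ 1 → app π p ≡ punchIn i (app σ (collapse i p))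
      app-insertAfter1-≢1 {p} r p≢1 =
        trans (app-tabulate image (suc (length σ)) p (subst (λ l → InRange (suc l) p) (sym (length≡ P)) r))
              (if-false (≡ᵇ-false p 1 p≢1))

      app-insertAfter1-expand : ∀ {x} → InRange m x → app π (expand i x) ≡ punchIn i (app σ x)
      app-insertAfter1-expand {x} r =
        trans (app-insertAfter1-≢1 (expand-range r) (expand≢1 x)) (cong (punchIn i ∘ app σ) (collapse-expand x))

      app-insertAfter1-punchIn : ∀ {x} → InRange m x → x ≢ 1 → app π (punchIn i x) ≡ punchIn i (app σ x)
      app-insertAfter1-punchIn r x≢1 = trans (cong (app π) (sym (expand-≢1 x≢1))) (app-insertAfter1-expand r)

      insertAfter1-isPerm : IsPerm (suc m) π
      insertAfter1-isPerm = record { length≡ = length-insertAfter1 ; app-range = range′ ; app-injective = injective }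
        where
        range′ : ∀ p → InRange (suc m) p → InRange (suc m) (app π p)
        range′ p r with p ≟ 1
        ... | yes refl = subst (InRange (suc m)) (sym app-insertAfter1-1) i-range
        ... | no  p≢1  = subst (InRange (suc m)) (sym (app-insertAfter1-≢1 r p≢1))
                           (punchIn-range i i≤ (app-range P _ (collapse-range r p≢1)))
        injective : ∀ p q → InRange (suc m) p → InRange (suc m) q → app π p ≡ app π q → p ≡ q
        injective p q rp rq e with p ≟ 1 | q ≟ 1
        ... | yes refl | yes refl = refl
        ... | yes refl | no  q≢1  =
          ⊥-elim (punchIn≢ i _ (sym (trans (sym app-insertAfter1-1) (trans e (app-insertAfter1-≢1 rq q≢1)))))
        ... | no  p≢1  | yes refl =
          ⊥-elim (punchIn≢ i _ (trans (sym (app-insertAfter1-≢1 rp p≢1)) (trans e app-insertAfter1-1)))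
        ... | no  p≢1  | no  q≢1  =
          trans (sym (expand-collapse p≢1)) (trans (cong (expand i) collapse≡) (expand-collapse q≢1))
          where
          collapse≡ : collapse i p ≡ collapse i q
          collapse≡ = app-injective P _ _ (collapse-range rp p≢1) (collapse-range rq q≢1)
            (punchIn-injective i (trans (sym (app-insertAfter1-≢1 rp p≢1)) (trans e (app-insertAfter1-≢1 rq q≢1))))

      removeAfter1-insertAfter1 : removeAfter1 i π ≡ σ
      removeAfter1-insertAfter1 = app-ext _ _ (trans length-remove (sym (length≡ P))) λ x r → begin
        app (removeAfter1 i π) x
          ≡⟨ app-tabulate _ (pred (length π)) x (subst (λ l → InRange l x) (length-tabulate _ _) r) ⟩
        punchOut i (app π (expand i x))
          ≡⟨ cong (punchOut i) (app-insertAfter1-expand (subst (λ l → InRange l x) length-remove r)) ⟩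
        punchOut i (punchIn i (app σ x))
          ≡⟨ punchOut-punchIn i _ ⟩
        app σ x ∎
        where
        open ≡-Reasoning
        length-remove : length (removeAfter1 i π) ≡ m
        length-remove = trans (length-tabulate _ _) (cong pred length-insertAfter1)

      private
        Pπ = insertAfter1-isPerm

      -- Away from 1, π is σ conjugated by punchIn i, so walks that avoid 1 correspond.
      walk-insertAfter1 : ∀ t f j → InRange m j → (∀ k → iter σ k j ≡ 1 → t ≡ 1) →
        walk π (punchIn i t) f (punchIn i j) ≡ map (punchIn i) (walk σ t f j)
      walk-insertAfter1 t zero    j _ _ = refl
      walk-insertAfter1 t (suc f) j r meets1 with j ≟ t
      ... | yes refl =
        trans (if-true (≡ᵇ-true (punchIn i j) _ refl)) (cong (map (punchIn i)) (sym (if-true (≡ᵇ-true j j refl))))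
      ... | no  j≢t  = begin
        walk π (punchIn i t) (suc f) (punchIn i j)
          ≡⟨ if-false (≡ᵇ-false (punchIn i j) (punchIn i t) (j≢t ∘ punchIn-injective i)) ⟩
        punchIn i j ∷ walk π (punchIn i t) f (app π (punchIn i j))
          ≡⟨ cong (λ y → punchIn i j ∷ walk π (punchIn i t) f y) (app-insertAfter1-punchIn r j≢1) ⟩
        punchIn i j ∷ walk π (punchIn i t) f (punchIn i (app σ j))
          ≡⟨ cong (punchIn i j ∷_) (walk-insertAfter1 t f (app σ j) (app-range P j r) meets1′) ⟩
        map (punchIn i) (j ∷ walk σ t f (app σ j))
          ≡⟨ cong (map (punchIn i)) (sym (if-false (≡ᵇ-false j t j≢t))) ⟩
        map (punchIn i) (walk σ t (suc f) j) ∎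
        where
        open ≡-Reasoning
        j≢1 : j ≢ 1
        j≢1 j≡1 = j≢t (trans j≡1 (sym (meets1 0 j≡1)))
        meets1′ : ∀ k → iter σ k (app σ j) ≡ 1 → t ≡ 1
        meets1′ k e = meets1 (suc k) (trans (sym (iter-app σ k j)) e)

      cycleFrom-insertAfter1-1 : cycleFrom π 1 ≡ i ∷ map (punchIn i) (cycleFrom σ 1)
      cycleFrom-insertAfter1-1 = begin
        cycleFrom π 1
          ≡⟨ cycleFrom≡walk π 1 ⟩
        walk π 1 (length π) (app π 1)
          ≡⟨ cong₂ (walk π 1) length-insertAfter1 app-insertAfter1-1 ⟩
        walk π 1 (suc m) i
          ≡⟨ if-false (≡ᵇ-false i 1 i≢1) ⟩
        i ∷ walk π 1 m (app π i)
          ≡⟨ cong₂ (λ t j → i ∷ walk π t m j) (sym (punchIn-1 i 2≤i)) (app-insertAfter1-expand 1-range) ⟩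
        i ∷ walk π (punchIn i 1) m (punchIn i (app σ 1))
          ≡⟨ cong (i ∷_) (walk-insertAfter1 1 m (app σ 1) (app-range P 1 1-range) (λ _ _ → refl)) ⟩
        i ∷ map (punchIn i) (walk σ 1 m (app σ 1))
          ≡⟨ cong (λ l → i ∷ map (punchIn i) (walk σ 1 l (app σ 1))) (sym (length≡ P)) ⟩
        i ∷ map (punchIn i) (cycleFrom σ 1) ∎
        where open ≡-Reasoning

      cycleOf-insertAfter1 : ∀ {c} → InRange m c → 2 ≤ c → isCycleMin σ c ≡ true →
        cycleOf π (punchIn i c) ≡ map (punchIn i) (cycleOf σ c)
      cycleOf-insertAfter1 {c} r 2≤c c-min = cong (punchIn i c ∷_) (begin
        cycleFrom π (punchIn i c)
          ≡⟨ cycleFrom≡walk π _ ⟩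
        walk π (punchIn i c) (length π) (app π (punchIn i c))
          ≡⟨ cong₂ (walk π (punchIn i c)) length-insertAfter1 (app-insertAfter1-punchIn r c≢1) ⟩
        walk π (punchIn i c) (suc m) (punchIn i (app σ c))
          ≡⟨ walk-insertAfter1 c (suc m) (app σ c) (app-range P c r) meets1 ⟩
        map (punchIn i) (walk σ c (1 + m) (app σ c))
          ≡⟨ cong (map (punchIn i)) (walk-fuel σ c m (app σ c) (cycle-closes P r) 1) ⟩
        map (punchIn i) (walk σ c m (app σ c))
          ≡⟨ cong (λ l → map (punchIn i) (walk σ c l (app σ c))) (sym (length≡ P)) ⟩
        map (punchIn i) (cycleFrom σ c) ∎)
        where
        open ≡-Reasoning
        c≢1 : c ≢ 1
        c≢1 refl = <-irrefl refl 2≤c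
        meets1 : ∀ k → iter σ k (app σ c) ≡ 1 → c ≡ 1
        meets1 k e = ⊥-elim (<⇒≱ 2≤c
          (subst (c ≤_) (trans (sym (iter-app σ k c)) e) (isCycleMin⇒≤iter P r c-min (suc k))))

      iter-insertAfter1 : ∀ {x} → InRange m x → ∀ k → ∃[ k′ ] (iter π k′ (punchIn i x) ≡ punchIn i (iter σ k x))
      iter-insertAfter1 r zero = 0 , refl
      iter-insertAfter1 {x} r (suc k) with iter-insertAfter1 r k | iter σ k x ≟ 1
      ... | k′ , e | no  σᵏx≢1 = suc k′ , trans (cong (app π) e) (app-insertAfter1-punchIn (iter-range P k r) σᵏx≢1)
      ... | k′ , e | yes σᵏx≡1 = suc (suc k′) , (begin
        app π (app π (iter π k′ (punchIn i x)))  ≡⟨ cong (app π ∘ app π) (trans e (cong (punchIn i) σᵏx≡1)) ⟩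
        app π (app π (punchIn i 1))              ≡⟨ cong (app π ∘ app π) (punchIn-1 i 2≤i) ⟩
        app π (app π 1)                          ≡⟨ cong (app π) app-insertAfter1-1 ⟩
        app π i                                  ≡⟨ app-insertAfter1-expand 1-range ⟩
        punchIn i (app σ 1)                      ≡⟨ cong (punchIn i ∘ app σ) (sym σᵏx≡1) ⟩
        punchIn i (app σ (iter σ k x))           ∎)
        where open ≡-Reasoning

      isCycleMin-insertAfter1 : ∀ {x} → InRange m x → 2 ≤ x → isCycleMin π (punchIn i x) ≡ isCycleMin σ x
      isCycleMin-insertAfter1 {x} r 2≤x = bool-ext from-π to-π
        where
        from-π : isCycleMin π (punchIn i x) ≡ true → isCycleMin σ x ≡ true
        from-π π-min = ≤iter⇒isCycleMin σ x λ k →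
          let k′ , e = iter-insertAfter1 r k
          in punchIn-cancel-≤ i (subst (punchIn i x ≤_) e (isCycleMin⇒≤iter Pπ (punchIn-range i i≤ r) π-min k′))
        to-π : isCycleMin σ x ≡ true → isCycleMin π (punchIn i x) ≡ true
        to-π σ-min = subst (λ l → all (punchIn i x ≤ᵇ_) l ≡ true) (sym (cycleOf-insertAfter1 r 2≤x σ-min))
          (all-true⁺ _ (map (punchIn i) (cycleOf σ x)) λ z∈ →
            let z , z∈′ , e = ∈-map⁻ (punchIn i) z∈
                x≤z = ≤ᵇ-true⁻ x z (all-true⁻ (x ≤ᵇ_) σ-min z∈′)
            in subst (λ y → (punchIn i x ≤ᵇ y) ≡ true) (sym e) (≤ᵇ-true _ _ (punchIn-mono-≤ i x≤z)))

      isCycleMin-insertAfter1-i : isCycleMin π i ≡ false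
      isCycleMin-insertAfter1-i = ¬-not λ i-min →
        let K , πᴷi≡1 = i-reaches-1 (iter-returns Pπ (s≤s z≤n , s≤s z≤n))
        in <⇒≱ 2≤i (subst (i ≤_) πᴷi≡1 (isCycleMin⇒≤iter Pπ i-range i-min K))
        where
        i-reaches-1 : ∃[ K ] (1 ≤ K × K ≤ suc m × iter π K 1 ≡ 1) → ∃[ K ] (iter π K i ≡ 1)
        i-reaches-1 (suc K , _ , _ , πᴷ⁺¹1≡1) =
          K , trans (cong (iter π K) (sym app-insertAfter1-1)) (trans (iter-app π K 1) πᴷ⁺¹1≡1)

      laterLeaders-insertAfter1 : laterLeaders π (suc m) ≡ map (punchIn i) (laterLeaders σ m)
      laterLeaders-insertAfter1 = begin
        filter (true? (isCycleMin π)) (range 2 m)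
          ≡⟨ cong (filter (true? (isCycleMin π)) ∘ range 2) m≡ ⟩
        filter (true? (isCycleMin π)) (range 2 (suc (m ∸ 1)))
          ≡⟨ filter-range-punchIn i (isCycleMin π) 2 (m ∸ 1) 2≤i (subst (i ≤_) (cong suc m≡) i≤)
                                  isCycleMin-insertAfter1-i ⟩
        filter (true? (isCycleMin π)) (map (punchIn i) (range 2 (m ∸ 1)))
          ≡⟨ filter-map (true? (isCycleMin π)) (punchIn i) (range 2 (m ∸ 1)) ⟩
        map (punchIn i) (filter (true? (isCycleMin π ∘ punchIn i)) (range 2 (m ∸ 1)))
          ≡⟨ cong (map (punchIn i)) (filter-true?-cong _ _ (range 2 (m ∸ 1)) leaders≡) ⟩
        map (punchIn i) (laterLeaders σ m) ∎
        where
        open ≡-Reasoning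
        m≡ : m ≡ suc (m ∸ 1)
        m≡ = sym (m+[n∸m]≡n 1≤m)
        leaders≡ : ∀ {x} → x ∈ range 2 (m ∸ 1) → isCycleMin π (punchIn i x) ≡ isCycleMin σ x
        leaders≡ {x} x∈ = let 2≤x , x< = ∈-range⁻ 2 (m ∸ 1) x∈ in
          isCycleMin-insertAfter1 (≤-trans (s≤s z≤n) 2≤x , s≤s⁻¹ (subst (x <_) (cong suc (sym m≡)) x<)) 2≤x

      concat-cycles-insertAfter1 : concat (map (cycleOf π) (laterLeaders π (suc m))) ≡
                                   map (punchIn i) (concat (map (cycleOf σ) (laterLeaders σ m)))
      concat-cycles-insertAfter1 = begin
        concat (map (cycleOf π) (laterLeaders π (suc m)))
          ≡⟨ cong (concat ∘ map (cycleOf π)) laterLeaders-insertAfter1 ⟩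
        concat (map (cycleOf π) (map (punchIn i) (laterLeaders σ m)))
          ≡⟨ cong concat (sym (map-∘ (laterLeaders σ m))) ⟩
        concat (map (cycleOf π ∘ punchIn i) (laterLeaders σ m))
          ≡⟨ cong concat (map-cong-local (All.tabulate cycle≡)) ⟩
        concat (map (map (punchIn i) ∘ cycleOf σ) (laterLeaders σ m))
          ≡⟨ cong concat (map-∘ (laterLeaders σ m)) ⟩
        concat (map (map (punchIn i)) (map (cycleOf σ) (laterLeaders σ m)))
          ≡⟨ concat-map (map (cycleOf σ) (laterLeaders σ m)) ⟩
        map (punchIn i) (concat (map (cycleOf σ) (laterLeaders σ m))) ∎
        where
        open ≡-Reasoning
        cycle≡ : ∀ {c} → c ∈ laterLeaders σ m → cycleOf π (punchIn i c) ≡ map (punchIn i) (cycleOf σ c)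
        cycle≡ c∈ = let (2≤c , c≤m) , c-min = ∈-laterLeaders⁻ {σ} 1≤m c∈ in
          cycleOf-insertAfter1 (≤-trans (s≤s z≤n) 2≤c , c≤m) 2≤c c-min

      flat-insertAfter1 : flat π ≡ 1 ∷ i ∷ map (punchIn i) (drop 1 (flat σ))
      flat-insertAfter1 = begin
        flat π
          ≡⟨ flat-laterLeaders Pπ (s≤s z≤n) ⟩
        1 ∷ cycleFrom π 1 ++ concat (map (cycleOf π) (laterLeaders π (suc m)))
          ≡⟨ cong₂ (λ c r → 1 ∷ c ++ r) cycleFrom-insertAfter1-1 concat-cycles-insertAfter1 ⟩
        1 ∷ i ∷ map (punchIn i) (cycleFrom σ 1) ++ map (punchIn i) (concat (map (cycleOf σ) (laterLeaders σ m)))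
          ≡⟨ cong (λ l → 1 ∷ i ∷ l) (sym (map-++ (punchIn i) (cycleFrom σ 1) _)) ⟩
        1 ∷ i ∷ map (punchIn i) (cycleFrom σ 1 ++ concat (map (cycleOf σ) (laterLeaders σ m)))
          ≡⟨ cong (λ l → 1 ∷ i ∷ map (punchIn i) (drop 1 l)) (sym (flat-laterLeaders P 1≤m)) ⟩
        1 ∷ i ∷ map (punchIn i) (drop 1 (flat σ)) ∎
        where open ≡-Reasoning

      μ-insertAfter1 : μ π ≡ μ σ
      μ-insertAfter1 = begin
        μ π                                                ≡⟨ μ-laterLeaders Pπ (s≤s z≤n) ⟩
        suc (length (laterLeaders π (suc m)))              ≡⟨ cong (suc ∘ length) laterLeaders-insertAfter1 ⟩
        suc (length (map (punchIn i) (laterLeaders σ m)))  ≡⟨ cong suc (length-map (punchIn i) (laterLeaders σ m)) ⟩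
        suc (length (laterLeaders σ m))                    ≡⟨ sym (μ-laterLeaders P 1≤m) ⟩
        μ σ                                                ∎
        where open ≡-Reasoning

    module _ {π : List ℕ} (P : IsPerm (suc m) π) (π1≡i : app π 1 ≡ i) where

      private
        σ = removeAfter1 i π

      length-removeAfter1 : length σ ≡ m
      length-removeAfter1 = trans (length-tabulate _ _) (cong pred (length≡ P))

      app-removeAfter1 : ∀ {x} → InRange m x → app σ x ≡ punchOut i (app π (expand i x))
      app-removeAfter1 {x} r =
        app-tabulate _ (pred (length π)) x (subst (λ l → InRange l x) (sym (cong pred (length≡ P))) r)

      app-expand≢i : ∀ {x} → InRange m x → app π (expand i x) ≢ i
      app-expand≢i {x} r e =
        expand≢1 x (app-injective P _ 1 (expand-range r) (s≤s z≤n , s≤s z≤n) (trans e (sym π1≡i)))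

      removeAfter1-isPerm : IsPerm m σ
      removeAfter1-isPerm = record { length≡ = length-removeAfter1 ; app-range = range′ ; app-injective = injective }
        where
        range′ : ∀ x → InRange m x → InRange m (app σ x)
        range′ x r = subst (InRange m) (sym (app-removeAfter1 r))
          (punchOut-range i 2≤i i≤ (app-range P _ (expand-range r)) (app-expand≢i r))
        injective : ∀ x y → InRange m x → InRange m y → app σ x ≡ app σ y → x ≡ y
        injective x y rx ry e =
          trans (sym (collapse-expand x)) (trans (cong (collapse i) expand≡) (collapse-expand y))
          where
          expand≡ : expand i x ≡ expand i y
          expand≡ = app-injective P _ _ (expand-range rx) (expand-range ry)
            (punchOut-injective i (app-expand≢i rx) (app-expand≢i ry)
              (trans (sym (app-removeAfter1 rx)) (trans e (app-removeAfter1 ry))))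

      insertAfter1-removeAfter1 : insertAfter1 i σ ≡ π
      insertAfter1-removeAfter1 =
        app-ext _ _ (trans (length-insertAfter1 removeAfter1-isPerm) (sym (length≡ P))) λ p r →
          same p (subst (λ l → InRange l p) (length-insertAfter1 removeAfter1-isPerm) r)
        where
        open ≡-Reasoning
        same : ∀ p → InRange (suc m) p → app (insertAfter1 i σ) p ≡ app π p
        same p r with p ≟ 1
        ... | yes refl = trans (app-insertAfter1-1 removeAfter1-isPerm) (sym π1≡i)
        ... | no  p≢1  = begin
          app (insertAfter1 i σ) p                                  ≡⟨ app-insertAfter1-≢1 removeAfter1-isPerm r p≢1 ⟩
          punchIn i (app σ (collapse i p))                          ≡⟨ cong (punchIn i) (app-removeAfter1 x-range) ⟩
          punchIn i (punchOut i (app π (expand i (collapse i p))))  ≡⟨ punchIn-punchOut i (app-expand≢i x-range) ⟩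
          app π (expand i (collapse i p))                           ≡⟨ cong (app π) (expand-collapse p≢1) ⟩
          app π p                                                   ∎
          where
          x-range = collapse-range r p≢1

-- Adjoining the fixed point 1

addFixed1 : List ℕ → List ℕ
addFixed1 ρ = 1 ∷ map suc ρ

dropFixed1 : List ℕ → List ℕ
dropFixed1 []      = []
dropFixed1 (_ ∷ r) = map pred r

suc-≤ᵇ : ∀ x y → (suc x ≤ᵇ suc y) ≡ (x ≤ᵇ y)
suc-≤ᵇ zero    y = refl
suc-≤ᵇ (suc x) y = refl

dropFixed1-addFixed1 : ∀ ρ → dropFixed1 (addFixed1 ρ) ≡ ρ
dropFixed1-addFixed1 ρ = trans (sym (map-∘ ρ)) (map-id ρ)

module _ {m ρ} (P : IsPerm m ρ) where

  private
    φ = addFixed1 ρ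

  app-addFixed1 : ∀ {x} → InRange m x → app φ (suc x) ≡ suc (app ρ x)
  app-addFixed1 {suc x} (_ , x<m) = app-map suc ρ (suc x) (inRange-length P (s≤s z≤n , x<m))

  addFixed1-isPerm : IsPerm (suc m) φ
  addFixed1-isPerm = record
    { length≡ = cong suc (trans (length-map suc ρ) (length≡ P)) ; app-range = range′ ; app-injective = injective }
    where
    range′ : ∀ p → InRange (suc m) p → InRange (suc m) (app φ p)
    range′ 1             _           = s≤s z≤n , s≤s z≤n
    range′ (suc (suc x)) (_ , s≤s x<m) = subst (InRange (suc m)) (sym (app-addFixed1 (s≤s z≤n , x<m)))
      (s≤s z≤n , s≤s (proj₂ (app-range P (suc x) (s≤s z≤n , x<m))))
    ≢1 : ∀ {x} → InRange m x → app φ (suc x) ≢ 1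
    ≢1 r e = <⇒≢ (s≤s (proj₁ (app-range P _ r))) (sym (trans (sym (app-addFixed1 r)) e))
    injective : ∀ p q → InRange (suc m) p → InRange (suc m) q → app φ p ≡ app φ q → p ≡ q
    injective 1             1             _             _             _ = refl
    injective 1             (suc (suc y)) _             (_ , s≤s y<m) e = ⊥-elim (≢1 (s≤s z≤n , y<m) (sym e))
    injective (suc (suc x)) 1             (_ , s≤s x<m) _             e = ⊥-elim (≢1 (s≤s z≤n , x<m) e)
    injective (suc (suc x)) (suc (suc y)) (_ , s≤s x<m) (_ , s≤s y<m) e =
      cong suc (app-injective P (suc x) (suc y) (s≤s z≤n , x<m) (s≤s z≤n , y<m)
        (suc-injective (trans (sym (app-addFixed1 (s≤s z≤n , x<m))) (trans e (app-addFixed1 (s≤s z≤n , y<m))))))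

  walk-addFixed1 : ∀ t f j → InRange m j → walk φ (suc t) f (suc j) ≡ map suc (walk ρ t f j)
  walk-addFixed1 t zero    j _ = refl
  walk-addFixed1 t (suc f) j r with j ≟ t
  ... | yes refl = trans (if-true (≡ᵇ-true (suc j) (suc j) refl)) (cong (map suc) (sym (if-true (≡ᵇ-true j j refl))))
  ... | no  j≢t  = begin
    walk φ (suc t) (suc f) (suc j)          ≡⟨ if-false (≡ᵇ-false (suc j) (suc t) (j≢t ∘ suc-injective)) ⟩
    suc j ∷ walk φ (suc t) f (app φ (suc j)) ≡⟨ cong (λ y → suc j ∷ walk φ (suc t) f y) (app-addFixed1 r) ⟩
    suc j ∷ walk φ (suc t) f (suc (app ρ j)) ≡⟨ cong (suc j ∷_) (walk-addFixed1 t f (app ρ j) (app-range P j r)) ⟩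
    map suc (j ∷ walk ρ t f (app ρ j))      ≡⟨ cong (map suc) (sym (if-false (≡ᵇ-false j t j≢t))) ⟩
    map suc (walk ρ t (suc f) j)            ∎
    where open ≡-Reasoning

  cycleOf-addFixed1 : ∀ {c} → InRange m c → cycleOf φ (suc c) ≡ map suc (cycleOf ρ c)
  cycleOf-addFixed1 {c} r = cong (suc c ∷_) (begin
    cycleFrom φ (suc c)                        ≡⟨ cycleFrom≡walk φ (suc c) ⟩
    walk φ (suc c) (length φ) (app φ (suc c))  ≡⟨ cong₂ (walk φ (suc c)) (length≡ addFixed1-isPerm) (app-addFixed1 r) ⟩
    walk φ (suc c) (suc m) (suc (app ρ c))     ≡⟨ walk-addFixed1 c (suc m) (app ρ c) (app-range P c r) ⟩
    map suc (walk ρ c (1 + m) (app ρ c))       ≡⟨ cong (map suc) (walk-fuel ρ c m (app ρ c) (cycle-closes P r) 1) ⟩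
    map suc (walk ρ c m (app ρ c))             ≡⟨ cong (λ l → map suc (walk ρ c l (app ρ c))) (sym (length≡ P)) ⟩
    map suc (cycleFrom ρ c)                    ∎)
    where open ≡-Reasoning

  isCycleMin-addFixed1 : ∀ {x} → InRange m x → isCycleMin φ (suc x) ≡ isCycleMin ρ x
  isCycleMin-addFixed1 {x} r = begin
    all (suc x ≤ᵇ_) (cycleOf φ (suc x))      ≡⟨ cong (all (suc x ≤ᵇ_)) (cycleOf-addFixed1 r) ⟩
    all (suc x ≤ᵇ_) (map suc (cycleOf ρ x))  ≡⟨ cong and (sym (map-∘ (cycleOf ρ x))) ⟩
    all ((suc x ≤ᵇ_) ∘ suc) (cycleOf ρ x)    ≡⟨ cong and (map-cong (suc-≤ᵇ x) (cycleOf ρ x)) ⟩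
    all (x ≤ᵇ_) (cycleOf ρ x)                ∎
    where open ≡-Reasoning

  cycleLeaders-addFixed1 : cycleLeaders φ ≡ 1 ∷ map suc (cycleLeaders ρ)
  cycleLeaders-addFixed1 = begin
    cycleLeaders φ
      ≡⟨ cycleLeaders-laterLeaders addFixed1-isPerm (s≤s z≤n) ⟩
    1 ∷ filter (true? (isCycleMin φ)) (range 2 m)
      ≡⟨ cong (λ l → 1 ∷ filter (true? (isCycleMin φ)) l) (sym (map-suc-range 1 m)) ⟩
    1 ∷ filter (true? (isCycleMin φ)) (map suc (range 1 m))
      ≡⟨ cong (1 ∷_) (filter-map (true? (isCycleMin φ)) suc (range 1 m)) ⟩
    1 ∷ map suc (filter (true? (isCycleMin φ ∘ suc)) (range 1 m))
      ≡⟨ cong (λ l → 1 ∷ map suc l) (filter-true?-cong _ _ (range 1 m) λ x∈ →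
           isCycleMin-addFixed1 (∈-range1⁻ m (subst (_ ∈_) (sym (range1≡range m)) x∈))) ⟩
    1 ∷ map suc (filter (true? (isCycleMin ρ)) (range 1 m))
      ≡⟨ cong (λ l → 1 ∷ map suc (filter (true? (isCycleMin ρ)) l)) (sym (range1≡range m)) ⟩
    1 ∷ map suc (filter (true? (isCycleMin ρ)) (range1 m))
      ≡⟨ cong (λ l → 1 ∷ map suc (filter (true? (isCycleMin ρ)) (range1 l))) (sym (length≡ P)) ⟩
    1 ∷ map suc (cycleLeaders ρ) ∎
    where open ≡-Reasoning

  flat-addFixed1 : flat φ ≡ 1 ∷ map suc (flat ρ)
  flat-addFixed1 = begin
    concat (map (cycleOf φ) (cycleLeaders φ))
      ≡⟨ cong (concat ∘ map (cycleOf φ)) cycleLeaders-addFixed1 ⟩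
    1 ∷ concat (map (cycleOf φ) (map suc (cycleLeaders ρ)))
      ≡⟨ cong (λ l → 1 ∷ concat l) (sym (map-∘ (cycleLeaders ρ))) ⟩
    1 ∷ concat (map (cycleOf φ ∘ suc) (cycleLeaders ρ))
      ≡⟨ cong (λ l → 1 ∷ concat l) (map-cong-local (All.tabulate (cycleOf-addFixed1 ∘ proj₁ ∘ ∈-cycleLeaders⁻ P))) ⟩
    1 ∷ concat (map (map suc ∘ cycleOf ρ) (cycleLeaders ρ))
      ≡⟨ cong (λ l → 1 ∷ concat l) (map-∘ (cycleLeaders ρ)) ⟩
    1 ∷ concat (map (map suc) (map (cycleOf ρ) (cycleLeaders ρ)))
      ≡⟨ cong (1 ∷_) (concat-map (map (cycleOf ρ) (cycleLeaders ρ))) ⟩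
    1 ∷ map suc (flat ρ) ∎
    where open ≡-Reasoning

  μ-addFixed1 : μ φ ≡ suc (μ ρ)
  μ-addFixed1 = begin
    length (map (cycleOf φ) (cycleLeaders φ))  ≡⟨ length-map (cycleOf φ) (cycleLeaders φ) ⟩
    length (cycleLeaders φ)                    ≡⟨ cong length cycleLeaders-addFixed1 ⟩
    suc (length (map suc (cycleLeaders ρ)))    ≡⟨ cong suc (length-map suc (cycleLeaders ρ)) ⟩
    suc (length (cycleLeaders ρ))              ≡⟨ cong suc (sym (length-map (cycleOf ρ) (cycleLeaders ρ))) ⟩
    suc (μ ρ)                                  ∎
    where open ≡-Reasoning

app-dropFixed1 : ∀ {m σ} → IsPerm (suc m) σ → ∀ {x} → InRange m x → app (dropFixed1 σ) x ≡ pred (app σ (suc x))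
app-dropFixed1 {σ = _ ∷ r} P {suc x} (_ , x<m) =
  app-map pred r (suc x) (s≤s z≤n , subst (suc x ≤_) (sym (suc-injective (length≡ P))) x<m)

dropFixed1-isPerm : ∀ {m σ} → IsPerm (suc m) σ → app σ 1 ≡ 1 → IsPerm m (dropFixed1 σ)
dropFixed1-isPerm {m} {σ@(_ ∷ r)} P σ1≡1 = record
  { length≡ = trans (length-map pred r) (suc-injective (length≡ P)) ; app-range = range′ ; app-injective = injective }
  where
  suc-range : ∀ {x} → InRange m x → InRange (suc m) (suc x)
  suc-range (_ , x≤m) = s≤s z≤n , s≤s x≤m
  σ-suc≢1 : ∀ {x} → InRange m x → app σ (suc x) ≢ 1
  σ-suc≢1 r e =
    <⇒≢ (s≤s (proj₁ r)) (sym (app-injective P _ 1 (suc-range r) (s≤s z≤n , s≤s z≤n) (trans e (sym σ1≡1))))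
  range′ : ∀ x → InRange m x → InRange m (app (dropFixed1 σ) x)
  range′ x r rewrite app-dropFixed1 P r with app σ (suc x) | app-range P (suc x) (suc-range r) | σ-suc≢1 r
  ... | suc (suc y) | _ , s≤s y<m | _   = s≤s z≤n , y<m
  ... | 1           | _           | ≢1 = ⊥-elim (≢1 refl)
  injective : ∀ x y → InRange m x → InRange m y → app (dropFixed1 σ) x ≡ app (dropFixed1 σ) y → x ≡ y
  injective x y rx ry e = suc-injective (app-injective P _ _ (suc-range rx) (suc-range ry)
    (pred-injective {{inRange-nonZero (app-range P _ (suc-range rx))}}
                    {{inRange-nonZero (app-range P _ (suc-range ry))}}
      (trans (sym (app-dropFixed1 P rx)) (trans e (app-dropFixed1 P ry)))))

addFixed1-dropFixed1 : ∀ {m σ} → IsPerm (suc m) σ → app σ 1 ≡ 1 → addFixed1 (dropFixed1 σ) ≡ σ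
addFixed1-dropFixed1 {σ = a ∷ r} P σ1≡1 =
  cong₂ _∷_ (sym σ1≡1) (trans (sym (map-∘ r)) (map-id-local (All.tabulate (suc-pred-∈ ∘ there))))
  where
  suc-pred-∈ : ∀ {z} → z ∈ a ∷ r → suc (pred z) ≡ z
  suc-pred-∈ z∈ with ∈⇒app (a ∷ r) z∈
  ... | p , rp , refl = suc-pred _ {{inRange-nonZero (app-range P p (subst (λ l → InRange l p) (length≡ P) rp))}}

flat-head : ∀ {m σ} → IsPerm m σ → 1 ≤ m → app σ 1 ≢ 1 → ∃[ w ] (flat σ ≡ 1 ∷ app σ 1 ∷ w)
flat-head {m} {σ} P 1≤m σ1≢1 =
  let rest , e = cycleFrom-1 P 1≤m σ1≢1
  in _ , trans (flat-laterLeaders P 1≤m) (cong (λ c → 1 ∷ c ++ concat (map (cycleOf σ) (laterLeaders σ m))) e)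

flat-addFixed1-head : ∀ {m ρ} → IsPerm m ρ → 1 ≤ m →
  ∃[ w ] (flat (addFixed1 ρ) ≡ 1 ∷ 2 ∷ map suc w × flat ρ ≡ 1 ∷ w)
flat-addFixed1-head P 1≤m =
  _ , trans (flat-addFixed1 P) (cong (λ l → 1 ∷ map suc l) (flat-laterLeaders P 1≤m)) , flat-laterLeaders P 1≤m

flat-head-fixed : ∀ {m σ} → IsPerm m σ → 2 ≤ m → app σ 1 ≡ 1 → ∃[ w ] (flat σ ≡ 1 ∷ 2 ∷ w)
flat-head-fixed {suc m} {σ} P (s≤s 1≤m) σ1≡1 =
  let w , e , _ = flat-addFixed1-head (dropFixed1-isPerm P σ1≡1) 1≤m
  in map suc w , trans (cong flat (sym (addFixed1-dropFixed1 P σ1≡1))) e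

-- Derangements avoiding 21-3

record Good (w : List ℕ) : Set where
  constructor good⁺
  field
    good⇒isDerangement : isDerangement w ≡ true
    good⇒avoids : contains21-3 (flat w) ≡ false
open Good

good⇔ : ∀ w → (isDerangement w ∧ avoids21-3 (flat w)) ≡ true ⇔ Good w
good⇔ w = mk⇔
  (λ g → good⁺ (∧-trueˡ g) (trans (sym (not-involutive _)) (cong not (∧-trueʳ {isDerangement w} g))))
  (λ (good⁺ d c) → cong₂ _∧_ d (cong not c))

good-transfer : ∀ {v w} → isDerangement v ≡ true ⇔ isDerangement w ≡ true →
  contains21-3 (flat v) ≡ contains21-3 (flat w) → Good v ⇔ Good w
good-transfer d⇔ c≡ = mk⇔
  (λ (good⁺ d c) → good⁺ (Equivalence.to d⇔ d) (trans (sym c≡) c))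
  (λ (good⁺ d c) → good⁺ (Equivalence.from d⇔ d) (trans c≡ c))

good⇒app1≢1 : ∀ {m σ} → IsPerm m σ → 1 ≤ m → Good σ → app σ 1 ≢ 1
good⇒app1≢1 {σ = σ} P 1≤m g = isDerangement⁻ σ (good⇒isDerangement g) 1 (inRange-length P (s≤s z≤n , 1≤m))

NoFixedPointBut1 : ℕ → List ℕ → Set
NoFixedPointBut1 m σ = ∀ x → InRange m x → x ≢ 1 → app σ x ≢ x

isDerangement⇔noFixedPointBut1 : ∀ {m σ} → IsPerm m σ → app σ 1 ≢ 1 →
  isDerangement σ ≡ true ⇔ NoFixedPointBut1 m σ
isDerangement⇔noFixedPointBut1 {m} {σ} P σ1≢1 = mk⇔
  (λ d x r _ → isDerangement⁻ σ d x (inRange-length P r))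
  (λ h → isDerangement⁺ σ λ x r → fixed x (subst (λ l → InRange l x) (length≡ P) r) h)
  where
  fixed : ∀ x → InRange m x → NoFixedPointBut1 m σ → app σ x ≢ x
  fixed x r h with x ≟ 1
  ... | yes refl = σ1≢1
  ... | no  x≢1  = h x r x≢1

noFixedPointBut1-addFixed1 : ∀ {m ρ} → IsPerm m ρ →
  NoFixedPointBut1 (suc m) (addFixed1 ρ) ⇔ isDerangement ρ ≡ true
noFixedPointBut1-addFixed1 {m} {ρ} P = mk⇔
  (λ h → isDerangement⁺ ρ λ x r e →
    let r′ = subst (λ l → InRange l x) (length≡ P) r
    in h (suc x) (s≤s z≤n , s≤s (proj₂ r′)) (λ sx≡1 → <⇒≢ (proj₁ r′) (sym (suc-injective sx≡1)))
         (trans (app-addFixed1 P r′) (cong suc e)))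
  (λ d → λ { 1 _ 1≢1 → ⊥-elim (1≢1 refl)
           ; (suc (suc x)) (_ , s≤s x<m) _ e →
               isDerangement⁻ ρ d (suc x) (inRange-length P (s≤s z≤n , x<m))
                 (suc-injective (trans (sym (app-addFixed1 P (s≤s z≤n , x<m))) e)) })

module _ {i m : ℕ} (2≤i : 2 ≤ i) (i≤ : i ≤ suc m) {σ : List ℕ} (P : IsPerm m σ) where

  private
    π = insertAfter1 i σ
    Pπ = insertAfter1-isPerm 2≤i i≤ P

    1≤m : 1 ≤ m
    1≤m = s≤s⁻¹ (≤-trans 2≤i i≤)

    punchIn-app≢expand : NoFixedPointBut1 m σ → ∀ {x} → InRange m x → punchIn i (app σ x) ≢ expand i x
    punchIn-app≢expand h {x} r e with x ≟ 1
    ... | yes refl = punchIn≢ i (app σ 1) e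
    ... | no  x≢1  = h x r x≢1 (punchIn-injective i (trans e (expand-≢1 2≤i x≢1)))

    flat-insertAfter1-head : ∀ {a w} → flat σ ≡ 1 ∷ a ∷ w → flat π ≡ 1 ∷ i ∷ map (punchIn i) (a ∷ w)
    flat-insertAfter1-head e = trans (flat-insertAfter1 2≤i i≤ P) (cong (λ l → 1 ∷ i ∷ map (punchIn i) (drop 1 l)) e)

  isDerangement-insertAfter1 : isDerangement π ≡ true ⇔ NoFixedPointBut1 m σ
  isDerangement-insertAfter1 = mk⇔
    (λ d x r x≢1 σx≡x → isDerangement⁻ π d (punchIn i x) (inRange-length Pπ (punchIn-range i i≤ r))
      (trans (app-insertAfter1-punchIn 2≤i i≤ P r x≢1) (cong (punchIn i) σx≡x)))
    (λ h → isDerangement⁺ π λ p r → not-fixed h p (subst (λ l → InRange l p) (length≡ Pπ) r))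
    where
    not-fixed : NoFixedPointBut1 m σ → ∀ p → InRange (suc m) p → app π p ≢ p
    not-fixed h p r with p ≟ 1
    ... | yes refl = i≢1 2≤i ∘ trans (sym (app-insertAfter1-1 2≤i i≤ P))
    ... | no  p≢1  = λ e → punchIn-app≢expand h (collapse-range 2≤i i≤ r p≢1) (begin
      punchIn i (app σ (collapse i p))  ≡⟨ sym (app-insertAfter1-≢1 2≤i i≤ P r p≢1) ⟩
      app π p                           ≡⟨ e ⟩
      p                                 ≡⟨ sym (expand-collapse 2≤i p≢1) ⟩
      expand i (collapse i p)           ∎)
      where open ≡-Reasoning

  contains21-3-insertAfter1 : ∀ {a w} → flat σ ≡ 1 ∷ a ∷ w → i ≤ a ⊎ i ≡ suc m →
    contains21-3 (flat π) ≡ contains21-3 (flat σ)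
  contains21-3-insertAfter1 {a} {w} e i≤a⊎i≡ = begin
    contains21-3 (flat π)                           ≡⟨ cong contains21-3 (flat-insertAfter1-head e) ⟩
    contains21-3 (1 ∷ i ∷ map (punchIn i) (a ∷ w))  ≡⟨ without-i i≤a⊎i≡ ⟩
    contains21-3 (a ∷ w)                            ≡⟨ sym (contains21-3-1∷ w (proj₁ (flat-range P 1≤m a∈))) ⟩
    contains21-3 (1 ∷ a ∷ w)                        ≡⟨ cong contains21-3 (sym e) ⟩
    contains21-3 (flat σ)                           ∎
    where
    open ≡-Reasoning
    1≤i = ≤-trans (s≤s z≤n) 2≤i
    a∈ : a ∈ flat σ
    a∈ = subst (a ∈_) (sym e) (there (here refl))
    without-i : i ≤ a ⊎ i ≡ suc m → contains21-3 (1 ∷ i ∷ map (punchIn i) (a ∷ w)) ≡ contains21-3 (a ∷ w)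
    without-i (inj₁ i≤a)  = contains21-3-insert-≤ i a w 1≤i i≤a
    without-i (inj₂ refl) = contains21-3-insert-max i a w 1≤i λ c∈ →
      s≤s (proj₂ (flat-range P 1≤m (subst (_ ∈_) (sym e) (there (there c∈)))))

  -- The letter punchIn i m = m + 1 completes the descent from i.
  contains21-3-insertAfter1-true : ∀ {a w} → flat σ ≡ 1 ∷ a ∷ w → a < i → i ≤ m → contains21-3 (flat π) ≡ true
  contains21-3-insertAfter1-true {a} {w} e a<i i≤m = trans (cong contains21-3 (flat-insertAfter1-head e))
    (contains21-3-insert-true i a w (≤-trans (s≤s z≤n) 2≤i) a<i m∈w i≤m)
    where
    m∈w : m ∈ w
    m∈w with subst (m ∈_) e (∈-flat P 1≤m (1≤m , ≤-refl))
    ... | here m≡1         = ⊥-elim (<⇒≢ (≤-trans 2≤i i≤m) (sym m≡1))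
    ... | there (here m≡a) = ⊥-elim (<⇒≱ a<i (subst (i ≤_) m≡a i≤m))
    ... | there (there m∈) = m∈

  good-insertAfter1 : app σ 1 ≢ 1 → i ≤ app σ 1 ⊎ i ≡ suc m → Good π ⇔ Good σ
  good-insertAfter1 σ1≢1 i≤σ1⊎i≡ = good-transfer
    (⇔.trans isDerangement-insertAfter1 (⇔.sym (isDerangement⇔noFixedPointBut1 P σ1≢1)))
    (contains21-3-insertAfter1 (proj₂ (flat-head P 1≤m σ1≢1)) i≤σ1⊎i≡)

  good-insertAfter1-inner : 3 ≤ i → i ≤ m → Good π ⇔ (Good σ × i ≤ app σ 1)
  good-insertAfter1-inner 3≤i i≤m = mk⇔ to from
    where
    contains : ∀ {a w} → flat σ ≡ 1 ∷ a ∷ w → a < i → Good π → ⊥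
    contains e a<i g = false≢true (trans (sym (good⇒avoids g)) (contains21-3-insertAfter1-true e a<i i≤m))
    to : Good π → Good σ × i ≤ app σ 1
    to g with app σ 1 ≟ 1
    ... | yes σ1≡1 = ⊥-elim (contains (proj₂ (flat-head-fixed P (≤-trans 2≤i i≤m) σ1≡1)) 3≤i g)
    ... | no  σ1≢1 with app σ 1 <? i
    ...   | yes σ1<i = ⊥-elim (contains (proj₂ (flat-head P 1≤m σ1≢1)) σ1<i g)
    ...   | no  σ1≮i = Equivalence.to (good-insertAfter1 σ1≢1 (inj₁ (≮⇒≥ σ1≮i))) g , ≮⇒≥ σ1≮i
    from : Good σ × i ≤ app σ 1 → Good π
    from (g , i≤σ1) = Equivalence.from (good-insertAfter1 (good⇒app1≢1 P 1≤m g) (inj₁ i≤σ1)) g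

  good-insertAfter1-outer : i ≡ 2 ⊎ i ≡ suc m → app σ 1 ≢ 1 → Good π ⇔ Good σ
  good-insertAfter1-outer i≡ σ1≢1 = good-insertAfter1 σ1≢1 (Sum.map₁ i≤σ1 i≡)
    where
    i≤σ1 : i ≡ 2 → i ≤ app σ 1
    i≤σ1 refl = ≤∧≢⇒< (proj₁ (app-range P 1 (s≤s z≤n , 1≤m))) (σ1≢1 ∘ sym)

outer-bounds : ∀ {i m} → 1 ≤ m → i ≡ 2 ⊎ i ≡ suc m → 2 ≤ i × i ≤ suc m
outer-bounds 1≤m (inj₁ refl) = ≤-refl , s≤s 1≤m
outer-bounds 1≤m (inj₂ refl) = s≤s 1≤m , ≤-refl

module _ {i m : ℕ} (i≡ : i ≡ 2 ⊎ i ≡ suc (suc m)) {ρ : List ℕ} (P : IsPerm m ρ) (1≤m : 1 ≤ m) where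

  private
    σ = addFixed1 ρ
    Pσ = addFixed1-isPerm P

    2≤i : 2 ≤ i
    2≤i = proj₁ (outer-bounds (s≤s z≤n) i≡)

    i≤ : i ≤ suc (suc m)
    i≤ = proj₂ (outer-bounds (s≤s z≤n) i≡)

  good-insertAfter1-addFixed1 : Good (insertAfter1 i σ) ⇔ Good ρ
  good-insertAfter1-addFixed1 = good-transfer
    (⇔.trans (isDerangement-insertAfter1 2≤i i≤ Pσ) (noFixedPointBut1-addFixed1 P))
    contains≡
    where
    open ≡-Reasoning
    w = proj₁ (flat-addFixed1-head P 1≤m)
    eσ = proj₁ (proj₂ (flat-addFixed1-head P 1≤m))
    eρ = proj₂ (proj₂ (flat-addFixed1-head P 1≤m))
    contains≡ : contains21-3 (flat (insertAfter1 i σ)) ≡ contains21-3 (flat ρ)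
    contains≡ = begin
      contains21-3 (flat (insertAfter1 i σ))  ≡⟨ contains21-3-insertAfter1 2≤i i≤ Pσ eσ (Sum.map₁ ≤-reflexive i≡) ⟩
      contains21-3 (flat σ)                   ≡⟨ cong contains21-3 eσ ⟩
      contains21-3 (1 ∷ 2 ∷ map suc w)        ≡⟨ contains21-3-1∷ (map suc w) (s≤s z≤n) ⟩
      contains21-3 (map suc (1 ∷ w))          ≡⟨ contains21-3-map suc (λ _ _ → refl) (1 ∷ w) ⟩
      contains21-3 (1 ∷ w)                    ≡⟨ cong contains21-3 (sym eρ) ⟩
      contains21-3 (flat ρ)                   ∎

  μ-insertAfter1-addFixed1 : μ (insertAfter1 i σ) ≡ suc (μ ρ)
  μ-insertAfter1-addFixed1 = trans (μ-insertAfter1 2≤i i≤ Pσ) (μ-addFixed1 P)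

-- Counting

count : ∀ {A : Set} {P : A → Set} → Decidable P → List A → ℕ
count P? xs = length (filter P? xs)

module _ {A : Set} {P Q : A → Set} (P? : Decidable P) (Q? : Decidable Q) where

  count-cong : ∀ xs → (∀ {x} → x ∈ xs → P x ⇔ Q x) → count P? xs ≡ count Q? xs
  count-cong []       _ = refl
  count-cong (x ∷ xs) h with P? x | Q? x
  ... | yes _ | yes _ = cong suc (count-cong xs (h ∘ there))
  ... | no  _ | no  _ = count-cong xs (h ∘ there)
  ... | yes p | no ¬q = ⊥-elim (¬q (Equivalence.to (h (here refl)) p))
  ... | no ¬p | yes q = ⊥-elim (¬p (Equivalence.from (h (here refl)) q))

  count-filter : ∀ xs → count P? (filter Q? xs) ≡ count (Q? ∩? P?) xs
  count-filter []       = refl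
  count-filter (x ∷ xs) with Q? x
  ... | no  _ = count-filter xs
  ... | yes _ with P? x
  ...   | yes _ = cong suc (count-filter xs)
  ...   | no  _ = count-filter xs

  count-split : ∀ xs → count P? xs ≡ count (P? ∩? Q?) xs + count (P? ∩? ¬? ∘ Q?) xs
  count-split []       = refl
  count-split (x ∷ xs) with P? x | Q? x
  ... | no  _ | _     = count-split xs
  ... | yes _ | yes _ = cong suc (count-split xs)
  ... | yes _ | no  _ = trans (cong suc (count-split xs)) (sym (+-suc _ _))

module _ {A : Set} {P : A → Set} (P? : Decidable P) where

  count-map : ∀ {B : Set} (T : B → A) xs → count P? (map T xs) ≡ count (P? ∘ T) xs
  count-map T []       = refl
  count-map T (x ∷ xs) with P? (T x)
  ... | yes _ = cong suc (count-map T xs)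
  ... | no  _ = count-map T xs

  count-none : ∀ xs → (∀ {x} → x ∈ xs → ¬ P x) → count P? xs ≡ 0
  count-none []       _ = refl
  count-none (x ∷ xs) h with P? x
  ... | yes p = ⊥-elim (h (here refl) p)
  ... | no  _ = count-none xs (h ∘ there)

  count-bag : ∀ {xs ys} → Unique xs → Unique ys → (∀ {z} → z ∈ xs ⇔ z ∈ ys) → count P? xs ≡ count P? ys
  count-bag uxs uys same =
    ↭-length (∼bag⇒↭ (unique∧set⇒bag (Unique.filter⁺ P? uxs) (Unique.filter⁺ P? uys) (mk⇔
      (λ z∈ → let z∈xs , pz = ∈-filter⁻ P? z∈ in ∈-filter⁺ P? (Equivalence.to same z∈xs) pz)
      (λ z∈ → let z∈ys , pz = ∈-filter⁻ P? z∈ in ∈-filter⁺ P? (Equivalence.from same z∈ys) pz))))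

map-unique : ∀ {A B : Set} (T : A → B) {xs} → Unique xs →
  (∀ {x y} → x ∈ xs → y ∈ xs → T x ≡ T y → x ≡ y) → Unique (map T xs)
map-unique T {[]}     _          _   = []
map-unique T {x ∷ xs} (x∉ ∷ uxs) inj =
  All.tabulate fresh ∷ map-unique T uxs (λ x∈ y∈ → inj (there x∈) (there y∈))
  where
  fresh : ∀ {y} → y ∈ map T xs → T x ≢ y
  fresh y∈ e = let z , z∈ , y≡ = ∈-map⁻ T y∈ in All.lookup x∉ z∈ (inj (here refl) (there z∈) (trans e y≡))

count-bijection : ∀ {A B : Set} {P R : B → Set} (P? : Decidable P) (R? : Decidable R) (T : A → B) (D : B → A) {xs ys} →
  Unique xs → Unique ys →
  (∀ {x} → x ∈ xs → T x ∈ ys × R (T x) × D (T x) ≡ x) →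
  (∀ {y} → y ∈ ys → R y → D y ∈ xs × T (D y) ≡ y) →
  count (R? ∩? P?) ys ≡ count (P? ∘ T) xs
count-bijection P? R? T D {xs} {ys} uxs uys forth back = begin
  count (R? ∩? P?) ys      ≡⟨ sym (count-filter P? R? ys) ⟩
  count P? (filter R? ys)  ≡⟨ count-bag P? (Unique.filter⁺ R? uys) (map-unique T uxs T-injective) (mk⇔ to from) ⟩
  count P? (map T xs)      ≡⟨ count-map P? T xs ⟩
  count (P? ∘ T) xs        ∎
  where
  open ≡-Reasoning
  T-injective : ∀ {x y} → x ∈ xs → y ∈ xs → T x ≡ T y → x ≡ y
  T-injective x∈ y∈ e = trans (sym (proj₂ (proj₂ (forth x∈)))) (trans (cong D e) (proj₂ (proj₂ (forth y∈))))
  to : ∀ {z} → z ∈ filter R? ys → z ∈ map T xs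
  to z∈ = let z∈ys , rz = ∈-filter⁻ R? z∈ ; Dz∈ , TDz≡z = back z∈ys rz in
    subst (_∈ map T xs) TDz≡z (∈-map⁺ T Dz∈)
  from : ∀ {z} → z ∈ map T xs → z ∈ filter R? ys
  from z∈ with ∈-map⁻ T z∈
  ... | x , x∈ , refl = let Tx∈ , rTx , _ = forth x∈ in ∈-filter⁺ R? Tx∈ rTx

module _ {A : Set} (h : A → ℕ) where

  InWindow : ℕ → ℕ → A → Set
  InWindow a c x = a ≤ h x × h x < a + c

  inWindow? : ∀ a c → Decidable (InWindow a c)
  inWindow? a c x = (a ≤? h x) ×-dec (h x <? a + c)

  sum-count-fibres : ∀ {P} (P? : Decidable P) xs a c →
    sum (map (λ j → count (P? ∩? (λ x → h x ≟ j)) xs) (range a c)) ≡ count (P? ∩? inWindow? a c) xs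
  sum-count-fibres P? xs a zero = sym (count-none (P? ∩? inWindow? a 0) xs λ {x} _ (_ , a≤ , <a+0) →
    <⇒≱ <a+0 (subst (_≤ h x) (sym (+-identityʳ a)) a≤))
  sum-count-fibres {P} P? xs a (suc c) = begin
    count (P? ∩? at? a) xs + sum (map (λ j → count (P? ∩? at? j) xs) (range (suc a) c))
      ≡⟨ cong (count (P? ∩? at? a) xs +_) (sum-count-fibres P? xs (suc a) c) ⟩
    count (P? ∩? at? a) xs + count (P? ∩? inWindow? (suc a) c) xs
      ≡⟨ sym (cong₂ _+_ (count-cong _ _ xs at-a) (count-cong _ _ xs above-a)) ⟩
    count ((P? ∩? inWindow? a (suc c)) ∩? at? a) xs + count ((P? ∩? inWindow? a (suc c)) ∩? ¬? ∘ at? a) xs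
      ≡⟨ sym (count-split (P? ∩? inWindow? a (suc c)) (at? a) xs) ⟩
    count (P? ∩? inWindow? a (suc c)) xs ∎
    where
    open ≡-Reasoning
    at? : ∀ j → Decidable (λ x → h x ≡ j)
    at? j x = h x ≟ j
    at-a : ∀ {x} → x ∈ xs → ((P x × InWindow a (suc c) x) × h x ≡ a) ⇔ (P x × h x ≡ a)
    at-a _ = mk⇔ (λ ((p , _) , e) → p , e)
      (λ (p , e) → (p , ≤-reflexive (sym e) , subst (_< a + suc c) (sym e) (m<m+n a z<s)) , e)
    above-a : ∀ {x} → x ∈ xs → ((P x × InWindow a (suc c) x) × h x ≢ a) ⇔ (P x × InWindow (suc a) c x)
    above-a {x} _ = mk⇔
      (λ ((p , a≤ , <) , ≢a) → p , ≤∧≢⇒< a≤ (≢a ∘ sym) , subst (h x <_) (+-suc a c) <)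
      (λ (p , a< , <) → (p , <⇒≤ a< , subst (h x <_) (sym (+-suc a c)) <) , λ e → <-irrefl (sym e) a<)

-- The polynomials as counts

good? : Decidable Good
good? w = Dec.map (good⇔ w) ((isDerangement w ∧ avoids21-3 (flat w)) Data.Bool.≟ true)

GoodWith : ℕ → List ℕ → Set
GoodWith k w = Good w × μ w ≡ k

goodWith? : ∀ k → Decidable (GoodWith k)
goodWith? k = good? ∩? (λ w → μ w ≟ k)

second≟ : ∀ i → Decidable (λ w → second (flat w) ≡ i)
second≟ i w = second (flat w) ≟ i

uI≡count : ∀ n i k → uI n i k ≡ count (goodWith? k ∩? second≟ i) (perms n)
uI≡count n i k = begin
  count (μ≟ k) (filter (second≟ i) (filter raw? (perms n)))
    ≡⟨ count-filter (μ≟ k) (second≟ i) (filter raw? (perms n)) ⟩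
  count (second≟ i ∩? μ≟ k) (filter raw? (perms n))
    ≡⟨ count-filter (second≟ i ∩? μ≟ k) raw? (perms n) ⟩
  count (raw? ∩? second≟ i ∩? μ≟ k) (perms n)
    ≡⟨ count-cong _ _ (perms n) (λ {w} _ → mk⇔
         (λ (g , s , e) → (Equivalence.to (good⇔ w) g , e) , s)
         (λ ((g , e) , s) → Equivalence.from (good⇔ w) g , s , e)) ⟩
  count (goodWith? k ∩? second≟ i) (perms n) ∎
  where
  open ≡-Reasoning
  raw? : Decidable (λ w → (isDerangement w ∧ avoids21-3 (flat w)) ≡ true)
  raw? w = (isDerangement w ∧ avoids21-3 (flat w)) Data.Bool.≟ true
  μ≟ : ∀ k → Decidable (λ w → μ w ≡ k)
  μ≟ k w = μ w ≟ k

-- u 1 = 0 by convention, which agrees with the count since [1] is not a derangement.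
u≡count : ∀ m k → u (suc m) k ≡ count (goodWith? k) (perms (suc m))
u≡count zero    k = refl
u≡count (suc m) k = trans (count-filter (λ w → μ w ≟ k) _ (perms (suc (suc m))))
  (count-cong _ _ (perms (suc (suc m))) λ {w} _ →
    mk⇔ (Product.map₁ (Equivalence.to (good⇔ w))) (Product.map₁ (Equivalence.from (good⇔ w))))

-- For a derangement π the second letter of flat π is π(1), and removeAfter1 i is a bijection from
-- the permutations with π(1) = i onto perms m.
uI≡count-insertAfter1 : ∀ {i m} k → 2 ≤ i → i ≤ suc m →
  uI (suc m) i k ≡ count (goodWith? k ∘ insertAfter1 i) (perms m)
uI≡count-insertAfter1 {i} {m} k 2≤i i≤ = begin
  uI (suc m) i k
    ≡⟨ uI≡count (suc m) i k ⟩
  count (goodWith? k ∩? second≟ i) (perms (suc m))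
    ≡⟨ count-cong _ _ (perms (suc m)) second≡π1 ⟩
  count ((λ π → app π 1 ≟ i) ∩? goodWith? k) (perms (suc m))
    ≡⟨ count-bijection (goodWith? k) (λ π → app π 1 ≟ i) (insertAfter1 i) (removeAfter1 i)
                       (perms-unique m) (perms-unique (suc m)) forth back ⟩
  count (goodWith? k ∘ insertAfter1 i) (perms m) ∎
  where
  open ≡-Reasoning
  second≡π1 : ∀ {π} → π ∈ perms (suc m) → (GoodWith k π × second (flat π) ≡ i) ⇔ (app π 1 ≡ i × GoodWith k π)
  second≡π1 {π} π∈ = mk⇔ (λ (gk , s) → trans (sym (second≡ gk)) s , gk) (λ (e , gk) → gk , trans (second≡ gk) e)
    where
    P = ∈-perms⁻ (suc m) π∈
    second≡ : GoodWith k π → second (flat π) ≡ app π 1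
    second≡ (g , _) = second-flat P (s≤s z≤n) (good⇒app1≢1 P (s≤s z≤n) g)
  forth : ∀ {σ} → σ ∈ perms m →
    insertAfter1 i σ ∈ perms (suc m) × app (insertAfter1 i σ) 1 ≡ i × removeAfter1 i (insertAfter1 i σ) ≡ σ
  forth σ∈ = let P = ∈-perms⁻ m σ∈ in
    ∈-perms⁺ (suc m) (insertAfter1-isPerm 2≤i i≤ P) , app-insertAfter1-1 2≤i i≤ P , removeAfter1-insertAfter1 2≤i i≤ P
  back : ∀ {π} → π ∈ perms (suc m) → app π 1 ≡ i →
    removeAfter1 i π ∈ perms m × insertAfter1 i (removeAfter1 i π) ≡ π
  back π∈ π1≡i = let P = ∈-perms⁻ (suc m) π∈ in
    ∈-perms⁺ m (removeAfter1-isPerm 2≤i i≤ P π1≡i) , insertAfter1-removeAfter1 2≤i i≤ P π1≡i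

uI-inner : ∀ {i m} k → 3 ≤ i → i ≤ m → uI (suc m) i k ≡ sumFromTo i m (λ j → uI m j) k
uI-inner {i} {m} k 3≤i i≤m = begin
  uI (suc m) i k
    ≡⟨ uI≡count-insertAfter1 k 2≤i i≤ ⟩
  count (goodWith? k ∘ insertAfter1 i) (perms m)
    ≡⟨ count-cong _ _ (perms m) window ⟩
  count (goodWith? k ∩? inWindow? (second ∘ flat) i c) (perms m)
    ≡⟨ sym (sum-count-fibres (second ∘ flat) (goodWith? k) (perms m) i c) ⟩
  sum (map (λ j → count (goodWith? k ∩? second≟ j) (perms m)) (range i c))
    ≡⟨ cong sum (map-cong (λ j → sym (uI≡count m j k)) (range i c)) ⟩
  sum (map (λ j → uI m j k) (range i c))
    ≡⟨ cong (sum ∘ map (λ j → uI m j k)) (sym (map-+-upTo≡range i c)) ⟩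
  sumFromTo i m (λ j → uI m j) k ∎
  where
  open ≡-Reasoning
  c = suc m ∸ i
  2≤i = ≤-trans (n≤1+n 2) 3≤i
  i≤ = m≤n⇒m≤1+n i≤m
  1≤m = ≤-trans (s≤s z≤n) (≤-trans 2≤i i≤m)
  window : ∀ {σ} → σ ∈ perms m → GoodWith k (insertAfter1 i σ) ⇔ (GoodWith k σ × InWindow (second ∘ flat) i c σ)
  window {σ} σ∈ = mk⇔
    (λ (gπ , e) → let gσ , i≤σ1 = Equivalence.to goodπ⇔ gπ in
      (gσ , trans (sym μπ≡μσ) e) , subst (i ≤_) (sym (second≡ gσ)) i≤σ1 , subst (_< i + c) (sym (second≡ gσ)) σ1<)
    (λ ((gσ , e) , i≤s , _) → Equivalence.from goodπ⇔ (gσ , subst (i ≤_) (second≡ gσ) i≤s) , trans μπ≡μσ e)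
    where
    P = ∈-perms⁻ m σ∈
    goodπ⇔ = good-insertAfter1-inner 2≤i i≤ P 3≤i i≤m
    μπ≡μσ = μ-insertAfter1 2≤i i≤ P
    second≡ : Good σ → second (flat σ) ≡ app σ 1
    second≡ g = second-flat P 1≤m (good⇒app1≢1 P 1≤m g)
    σ1< : app σ 1 < i + c
    σ1< = subst (app σ 1 <_) (sym (m+[n∸m]≡n i≤)) (s≤s (proj₂ (app-range P 1 (s≤s z≤n , 1≤m))))

module _ {i m : ℕ} (i≡ : i ≡ 2 ⊎ i ≡ suc (suc (suc m))) where

  private
    2≤i = proj₁ (outer-bounds (s≤s z≤n) i≡)
    i≤ = proj₂ (outer-bounds (s≤s z≤n) i≡)

    fixed? : Decidable (λ σ → app σ 1 ≡ 1)
    fixed? σ = app σ 1 ≟ 1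

  count-insertAfter1-unfixed : ∀ k →
    count (goodWith? k ∘ insertAfter1 i ∩? ¬? ∘ fixed?) (perms (suc (suc m))) ≡ u (suc (suc m)) k
  count-insertAfter1-unfixed k = trans (count-cong _ _ (perms (suc (suc m))) same) (sym (u≡count (suc m) k))
    where
    same : ∀ {σ} → σ ∈ perms (suc (suc m)) → (GoodWith k (insertAfter1 i σ) × app σ 1 ≢ 1) ⇔ GoodWith k σ
    same σ∈ = let P = ∈-perms⁻ _ σ∈ ; μπ≡μσ = μ-insertAfter1 2≤i i≤ P in mk⇔
      (λ ((gπ , e) , σ1≢1) → Equivalence.to (good-insertAfter1-outer 2≤i i≤ P i≡ σ1≢1) gπ , trans (sym μπ≡μσ) e)
      (λ (gσ , e) → let σ1≢1 = good⇒app1≢1 P (s≤s z≤n) gσ in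
        (Equivalence.from (good-insertAfter1-outer 2≤i i≤ P i≡ σ1≢1) gσ , trans μπ≡μσ e) , σ1≢1)

  count-insertAfter1-addFixed1 : ∀ k →
    count (goodWith? k ∘ insertAfter1 i ∘ addFixed1) (perms (suc m)) ≡ yP* (u (suc m)) k
  count-insertAfter1-addFixed1 zero = count-none _ (perms (suc m)) λ ρ∈ (_ , e) →
    0≢1+n (trans (sym e) (μ-insertAfter1-addFixed1 i≡ (∈-perms⁻ _ ρ∈) (s≤s z≤n)))
  count-insertAfter1-addFixed1 (suc k) = trans (count-cong _ _ (perms (suc m)) same) (sym (u≡count m k))
    where
    same : ∀ {ρ} → ρ ∈ perms (suc m) → GoodWith (suc k) (insertAfter1 i (addFixed1 ρ)) ⇔ GoodWith k ρ
    same ρ∈ = let P = ∈-perms⁻ _ ρ∈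
                  μπ≡1+μρ = μ-insertAfter1-addFixed1 i≡ P (s≤s z≤n)
                  goodπ⇔goodρ = good-insertAfter1-addFixed1 i≡ P (s≤s z≤n)
              in mk⇔
      (λ (gπ , e) → Equivalence.to goodπ⇔goodρ gπ , suc-injective (trans (sym μπ≡1+μρ) e))
      (λ (gρ , e) → Equivalence.from goodπ⇔goodρ gρ , trans μπ≡1+μρ (cong suc e))

  -- σ(1) = 1 exactly when σ = addFixed1 ρ, whose extra cycle accounts for the factor y.
  count-insertAfter1-fixed : ∀ k →
    count (goodWith? k ∘ insertAfter1 i ∩? fixed?) (perms (suc (suc m))) ≡ yP* (u (suc m)) k
  count-insertAfter1-fixed k = begin
    count (goodWith? k ∘ insertAfter1 i ∩? fixed?) (perms (suc (suc m)))
      ≡⟨ count-cong _ _ (perms (suc (suc m))) (λ _ → mk⇔ Product.swap Product.swap) ⟩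
    count (fixed? ∩? goodWith? k ∘ insertAfter1 i) (perms (suc (suc m)))
      ≡⟨ count-bijection (goodWith? k ∘ insertAfter1 i) fixed? addFixed1 dropFixed1
                         (perms-unique (suc m)) (perms-unique (suc (suc m))) forth back ⟩
    count (goodWith? k ∘ insertAfter1 i ∘ addFixed1) (perms (suc m))
      ≡⟨ count-insertAfter1-addFixed1 k ⟩
    yP* (u (suc m)) k ∎
    where
    open ≡-Reasoning
    forth : ∀ {ρ} → ρ ∈ perms (suc m) →
      addFixed1 ρ ∈ perms (suc (suc m)) × app (addFixed1 ρ) 1 ≡ 1 × dropFixed1 (addFixed1 ρ) ≡ ρ
    forth {ρ} ρ∈ = ∈-perms⁺ (suc (suc m)) (addFixed1-isPerm (∈-perms⁻ (suc m) ρ∈)) , refl , dropFixed1-addFixed1 ρ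
    back : ∀ {σ} → σ ∈ perms (suc (suc m)) → app σ 1 ≡ 1 →
      dropFixed1 σ ∈ perms (suc m) × addFixed1 (dropFixed1 σ) ≡ σ
    back σ∈ σ1≡1 = let P = ∈-perms⁻ (suc (suc m)) σ∈ in
      ∈-perms⁺ (suc m) (dropFixed1-isPerm P σ1≡1) , addFixed1-dropFixed1 P σ1≡1

  uI-outer : ∀ k → uI (suc (suc (suc m))) i k ≡ u (suc (suc m)) k + yP* (u (suc m)) k
  uI-outer k = begin
    uI (suc (suc (suc m))) i k
      ≡⟨ uI≡count-insertAfter1 k 2≤i i≤ ⟩
    count (goodWith? k ∘ insertAfter1 i) (perms (suc (suc m)))
      ≡⟨ count-split (goodWith? k ∘ insertAfter1 i) fixed? (perms (suc (suc m))) ⟩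
    count (goodWith? k ∘ insertAfter1 i ∩? fixed?) (perms (suc (suc m))) +
    count (goodWith? k ∘ insertAfter1 i ∩? ¬? ∘ fixed?) (perms (suc (suc m)))
      ≡⟨ cong₂ _+_ (count-insertAfter1-fixed k) (count-insertAfter1-unfixed k) ⟩
    yP* (u (suc m)) k + u (suc (suc m)) k
      ≡⟨ +-comm (yP* (u (suc m)) k) _ ⟩
    u (suc (suc m)) k + yP* (u (suc m)) k ∎
    where open ≡-Reasoning

uI-2-2 : uI 2 2 ≈P yP
uI-2-2 zero          = refl
uI-2-2 (suc zero)    = refl
uI-2-2 (suc (suc k)) = refl

lemma2p6 : (∀ (n : ℕ) → 4 ≤ n → ∀ (i : ℕ) → 3 ≤ i → i ≤ n ∸ 1 →
          uI n i ≈P sumFromTo i (n ∸ 1) (λ j → uI (n ∸ 1) j))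
    × (∀ (n : ℕ) → 3 ≤ n →
          (uI n 2 ≈P (u (n ∸ 1) +P yP* (u (n ∸ 2))))
        × (uI n n ≈P (u (n ∸ 1) +P yP* (u (n ∸ 2)))))
    × (uI 2 2 ≈P yP)
lemma2p6 = inner , outer , uI-2-2
  where
  inner : ∀ n → 4 ≤ n → ∀ i → 3 ≤ i → i ≤ n ∸ 1 → uI n i ≈P sumFromTo i (n ∸ 1) (λ j → uI (n ∸ 1) j)
  inner (suc m) _ i 3≤i i≤m k = uI-inner k 3≤i i≤m
  outer : ∀ n → 3 ≤ n →
    (uI n 2 ≈P (u (n ∸ 1) +P yP* (u (n ∸ 2)))) × (uI n n ≈P (u (n ∸ 1) +P yP* (u (n ∸ 2))))
  outer (suc (suc (suc m))) (s≤s (s≤s (s≤s _))) = uI-outer {m = m} (inj₁ refl) , uI-outer {m = m} (inj₂ refl)
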